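{- Let $n \geq 2$. (1) If $d \geq 0$ and $\{ac^d, mc^d\}$ is linearly independent, then $amc^d \neq 0$. (2) If $d \geq 1$ and $\{amc^{d-1}, c^d\}$ is linearly independent, then $ac^d + mc^d \neq 0$.
   Context: $\mathrm{OS}_n$ is the quotient of the exterior algebra over $\mathbb{Q}$ on generators $e_{ij}$, $1 \leq i < j \leq n+1$ (each of degree $1$), by the two-sided ideal generated by $e_{ik}e_{jk} - e_{ij}e_{jk} + e_{ij}e_{ik}$ for $1 \leq i<j<k \leq n+1$. Define $a = \sum_{1\leq i<j\leq n} e_{ij}$, $m = \sum_{1 \leq i \leq n} e_{i,n+1}$, and $c = \sum_{1 \leq i<j\leq n}\big(e_{ij}e_{i,n+1} + e_{ij}e_{j,n+1}\big)$ in $\mathrm{OS}_n$. -}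

module Defs where

open import Data.Nat as ℕ using (ℕ; zero; suc; _∸_)
open import Data.Bool using (Bool; true; false; if_then_else_; _∧_; _∨_)
open import Data.Fin as Fin using (Fin; toℕ; inject₁; fromℕ; _<?_)
open import Data.List using (List; []; _∷_; _++_; map; concatMap; foldr; allFin)
open import Data.Maybe using (Maybe; just; nothing)
open import Data.Product using (Σ; _×_; _,_; proj₁; proj₂)
open import Data.Rational as ℚ using (ℚ; 0ℚ; 1ℚ; -_)
open import Relation.Nullary using (yes; no; ¬_)
open import Relation.Binary.PropositionalEquality using (_≡_)
import Data.List.Properties as LP
import Data.Product.Properties as PP

-- Generators e_{ij}, 1 ≤ i < j ≤ n+1, encoded with 0-based indices
-- i j : Fin (suc n), together with a proof of i < j.

Gen : ℕ → Set
Gen n = Σ (Fin (suc n) × Fin (suc n)) (λ p → proj₁ p Fin.< proj₂ p)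

key : ∀ {n} → Gen n → ℕ × ℕ
key ((i , j) , _) = toℕ i , toℕ j

-- Words in the generators, and formal ℚ-linear combinations of words
-- (elements of the free/tensor algebra, presenting the exterior algebra).
Word : ℕ → Set
Word n = List (Gen n)

Elt : ℕ → Set
Elt n = List (ℚ × Word n)

infixl 6 _⊕_
infixl 7 _⊗_ _·_

_⊕_ : ∀ {n} → Elt n → Elt n → Elt n
x ⊕ y = x ++ y

_·_ : ∀ {n} → ℚ → Elt n → Elt n
α · x = map (λ t → (α ℚ.* proj₁ t , proj₂ t)) x

_⊗_ : ∀ {n} → Elt n → Elt n → Elt n
x ⊗ y = concatMap (λ s → map (λ t → (proj₁ s ℚ.* proj₁ t , proj₂ s ++ proj₂ t)) y) x

one : ∀ {n} → Elt n
one = (1ℚ , []) ∷ []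

_^_ : ∀ {n} → Elt n → ℕ → Elt n
x ^ zero = one
x ^ suc d = x ⊗ (x ^ d)

-- Exterior-algebra normal form: a word equals ±(strictly increasing
-- monomial) or 0 (repeated generator).  Generators ordered
-- lexicographically by (i , j).

_<K_ : ℕ × ℕ → ℕ × ℕ → Bool
(a , b) <K (c , d) = (a ℕ.<ᵇ c) ∨ ((a ℕ.≡ᵇ c) ∧ (b ℕ.<ᵇ d))

_=K_ : ℕ × ℕ → ℕ × ℕ → Bool
(a , b) =K (c , d) = (a ℕ.≡ᵇ c) ∧ (b ℕ.≡ᵇ d)

insertK : ℕ × ℕ → List (ℕ × ℕ) → Maybe (ℚ × List (ℕ × ℕ))
insertK k [] = just (1ℚ , k ∷ [])
insertK k (h ∷ t) with k <K h | k =K h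
... | true  | _     = just (1ℚ , k ∷ h ∷ t)
... | false | true  = nothing
... | false | false with insertK k t
...   | nothing = nothing
...   | just (s , t') = just (- s , h ∷ t')

normal : ∀ {n} → Word n → Maybe (ℚ × List (ℕ × ℕ))
normal [] = just (1ℚ , [])
normal (g ∷ w) with normal w
... | nothing = nothing
... | just (s , S) with insertK (key g) S
...   | nothing = nothing
...   | just (s' , S') = just (s ℚ.* s' , S')

coeffW : ∀ {n} → Word n → List (ℕ × ℕ) → ℚ
coeffW w S with normal w
... | nothing = 0ℚ
... | just (s , S') with LP.≡-dec (PP.≡-dec ℕ._≟_ ℕ._≟_) S' S
...   | yes _ = s
...   | no _  = 0ℚ

coeff : ∀ {n} → Elt n → List (ℕ × ℕ) → ℚ
coeff x S = foldr (λ t r → proj₁ t ℚ.* coeffW (proj₂ t) S ℚ.+ r) 0ℚ x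

_≈Λ_ : ∀ {n} → Elt n → Elt n → Set
x ≈Λ y = ∀ S → coeff x S ≡ coeff y S

-- e_{ij} as an element (zero if not i < j; only used with i < j)
e : ∀ {n} → Fin (suc n) → Fin (suc n) → Elt n
e i j with i <? j
... | yes p = (1ℚ , ((i , j) , p) ∷ []) ∷ []
... | no _  = []

rel : ∀ {n} → Fin (suc n) → Fin (suc n) → Fin (suc n) → Elt n
rel i j k = (e i k ⊗ e j k) ⊕ ((- 1ℚ) · (e i j ⊗ e j k)) ⊕ (e i j ⊗ e i k)

record RelTerm (n : ℕ) : Set where
  constructor relTerm
  field
    left  : Elt n
    i j k : Fin (suc n)
    i<j   : i Fin.< j
    j<k   : j Fin.< k
    right : Elt n

termOf : ∀ {n} → RelTerm n → Elt n
termOf t = RelTerm.left t ⊗ rel (RelTerm.i t) (RelTerm.j t) (RelTerm.k t) ⊗ RelTerm.right t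

sumTerms : ∀ {n} → List (RelTerm n) → Elt n
sumTerms [] = []
sumTerms (t ∷ ts) = termOf t ⊕ sumTerms ts

-- x is zero in OS_n  ⇔  x lies in the ideal generated by the relators
IsZeroOS : (n : ℕ) → Elt n → Set
IsZeroOS n x = Σ (List (RelTerm n)) (λ ts → x ≈Λ sumTerms ts)

LinIndep2 : (n : ℕ) → Elt n → Elt n → Set
LinIndep2 n x y = ∀ (α β : ℚ) → IsZeroOS n ((α · x) ⊕ (β · y)) → (α ≡ 0ℚ) × (β ≡ 0ℚ)

-- The elements a, m, c.  Index i (1-based) ↦ Fin value i-1; n+1 ↦ fromℕ n.

pairsSum : ∀ {n} → (Fin n → Fin n → Elt n) → Elt n
pairsSum {n} f = concatMap (λ i → concatMap (λ j → f i j) (allFin n)) (allFin n)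

aE : (n : ℕ) → Elt n
aE n = pairsSum {n} (λ i j → e (inject₁ i) (inject₁ j))

mE : (n : ℕ) → Elt n
mE n = concatMap (λ i → e (inject₁ i) (fromℕ n)) (allFin n)

cE : (n : ℕ) → Elt n
cE n = pairsSum {n} (λ i j →
  (e (inject₁ i) (inject₁ j) ⊗ e (inject₁ i) (fromℕ n))
  ⊕ (e (inject₁ i) (inject₁ j) ⊗ e (inject₁ j) (fromℕ n)))

{-# OPTIONS --safe #-}
module Submission where

-- The contraction ∂ of the exterior algebra with the functional e_ij ↦ 1 is a
-- derivation of degree −1 that kills every Orlik–Solomon relator, so it maps the OS ideal
-- into itself. Elements are handled through their coefficient functions on sorted monomials,
-- on which left multiplication by e_g and contraction with e_g^* act by removing and
-- inserting g; these operators satisfy the canonical anticommutation relations, which is what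
-- makes ∂ a derivation. Writing |x| (weight x) for the coefficient sum of x of degree one,
-- ∂c = (n − 1)m − 2a, hence am·∂(c^d) = 0 and (a + m)·∂(c^d) = γ_d·amc^(d−1), so that
--   ∂(amc^d) = |a|·mc^d − |m|·ac^d   and   ∂(ac^d + mc^d) = (|a| + |m|)·c^d − γ_d·amc^(d−1).
-- If amc^d (resp. ac^d + mc^d) vanished in OS_n, so would the right-hand side, and linear
-- independence would force |m| = 0 (resp. |a| + |m| = 0), whereas |m| = n > 0 and |a| ≥ 0.

open import Defs
open import Data.Nat using (ℕ; _≤_; _∸_)
open import Data.Product using (_×_)
open import Relation.Nullary using (¬_)

open import Algebra.Bundles using (CommutativeRing)
open import Data.Empty using (⊥-elim)
open import Data.Fin as Fin using (Fin; toℕ; inject₁; fromℕ)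
import Data.Fin.Properties as Finₚ
open import Data.List using (List; []; _∷_; _++_; map; concatMap; head; length; tabulate; allFin)
import Data.List.Properties as Listₚ
open import Data.List.Relation.Unary.All as All using (All; []; _∷_)
import Data.List.Relation.Unary.All.Properties as Allₚ
open import Data.List.Relation.Unary.Linked as Linked using (Linked; []; [-]; _∷_; _∷′_; head′)
open import Data.Maybe using (Maybe; just; nothing)
open import Data.Maybe.Relation.Binary.Connected using (Connected; just; just-nothing; connected?)
open import Data.Nat as ℕ using (zero; suc)
import Data.Nat.Properties as ℕₚ
open import Data.Product using (Σ; _,_; proj₁; proj₂)
import Data.Product.Properties as Productₚ
open import Data.Product.Relation.Binary.Lex.Strict using (×-Lex; ×-strictTotalOrder)
open import Data.Product.Relation.Binary.Pointwise.NonDependent using (≡×≡⇒≡; ≡⇒≡×≡)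
open import Data.Rational as ℚ using (ℚ; 0ℚ; 1ℚ)
import Data.Rational.Properties as ℚₚ
open import Function using (_∘_)
open import Relation.Binary using (Setoid; StrictTotalOrder; Tri; tri<; tri≈; tri>; Decidable)
open import Relation.Binary.PropositionalEquality
import Relation.Binary.Reasoning.Setoid as SetoidReasoning
open import Relation.Nullary using (Dec; yes; no)
open import Relation.Nullary.Decidable using (dec⇒maybe)
open import Relation.Nullary.Reflects using (Reflects; ofʸ; ofⁿ; fromEquivalence; det; _⊎-reflects_; _×-reflects_)
open import Tactic.RingSolver using (solve-∀)
import Tactic.RingSolver.Core.AlmostCommutativeRing as ACR

open import Algebra.Properties.Semiring.Sum (CommutativeRing.semiring ℚₚ.+-*-commutativeRing)
  using (sum; sum-cong-≗; sum-replicate-zero; sum-remove; ∑-distrib-+; ∑-comm; *-distribˡ-sum; *-distribʳ-sum)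

ℚ-ring : ACR.AlmostCommutativeRing _ _
ℚ-ring = ACR.fromCommutativeRing ℚₚ.+-*-commutativeRing (λ x → dec⇒maybe (0ℚ ℚₚ.≟ x))

neg-involutive : ∀ a → ℚ.- (ℚ.- a) ≡ a
neg-involutive = solve-∀ ℚ-ring

neg*neg : ∀ a b → ℚ.- a ℚ.* ℚ.- b ≡ a ℚ.* b
neg*neg = solve-∀ ℚ-ring

*-swap : ∀ a b c → a ℚ.* (b ℚ.* c) ≡ b ℚ.* (a ℚ.* c)
*-swap = solve-∀ ℚ-ring

*-+-regroup : ∀ a b c d → a ℚ.* b ℚ.* c ℚ.+ a ℚ.* d ≡ a ℚ.* (b ℚ.* c ℚ.+ d)
*-+-regroup = solve-∀ ℚ-ring

*-neg-+-neg : ∀ a b c → a ℚ.* ℚ.- b ℚ.+ ℚ.- c ≡ ℚ.- (a ℚ.* b ℚ.+ c)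
*-neg-+-neg = solve-∀ ℚ-ring

sign²-cancel : ∀ {s} a → s ℚ.* s ≡ 1ℚ → s ℚ.* s ℚ.* a ≡ a
sign²-cancel a s²≡1 = trans (cong (ℚ._* a) s²≡1) (ℚₚ.*-identityˡ a)

two : ℚ
two = 1ℚ ℚ.+ 1ℚ


∑-zero : ∀ {N} (f : Fin N → ℚ) → (∀ j → f j ≡ 0ℚ) → sum f ≡ 0ℚ
∑-zero {N} f f≡0 = trans (sum-cong-≗ f≡0) (sum-replicate-zero N)

∑-point : ∀ {N} (f : Fin N → ℚ) i → (∀ j → j ≢ i → f j ≡ 0ℚ) → sum f ≡ f i
∑-point {suc N} f i f≡0 =
  trans (sum-remove {i = i} f)
        (trans (cong (f i ℚ.+_) (∑-zero (f ∘ Fin.punchIn i) (λ j → f≡0 (Fin.punchIn i j) (Finₚ.punchInᵢ≢i i j))))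
               (ℚₚ.+-identityʳ (f i)))

∑∑-point : ∀ {M N} (f : Fin M → Fin N → ℚ) a b → (∀ i j → (i , j) ≢ (a , b) → f i j ≡ 0ℚ) →
       sum (λ i → sum (f i)) ≡ f a b
∑∑-point f a b f≡0 =
  trans (∑-point (λ i → sum (f i)) a (λ i i≢a → ∑-zero (f i) (λ j → f≡0 i j (i≢a ∘ cong proj₁))))
        (∑-point (f a) b (λ j j≢b → f≡0 a j (j≢b ∘ cong proj₂)))

∑∑-distrib-+ : ∀ {M N} (f g : Fin M → Fin N → ℚ) →
               sum (λ i → sum (λ j → f i j ℚ.+ g i j)) ≡ sum (λ i → sum (f i)) ℚ.+ sum (λ i → sum (g i))
∑∑-distrib-+ f g = trans (sum-cong-≗ {y = λ i → sum (f i) ℚ.+ sum (g i)} (λ i → ∑-distrib-+ (f i) (g i)))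
                          (∑-distrib-+ (λ i → sum (f i)) (λ i → sum (g i)))

∑∑-scale : ∀ {M N} c (h : Fin M → Fin N → ℚ) → sum (λ i → sum (λ j → c ℚ.* h i j)) ≡ c ℚ.* sum (λ i → sum (h i))
∑∑-scale c h = sym (trans (*-distribˡ-sum c (λ i → sum (h i))) (sum-cong-≗ (λ i → *-distribˡ-sum c (h i))))

𝟙 : ∀ {P : Set} → Dec P → ℚ
𝟙 (yes _) = 1ℚ
𝟙 (no _) = 0ℚ

𝟙-yes : ∀ {P : Set} → P → (d : Dec P) → 𝟙 d ≡ 1ℚ
𝟙-yes _ (yes _) = refl
𝟙-yes p (no ¬p) = ⊥-elim (¬p p)

𝟙-no : ∀ {P : Set} → ¬ P → (d : Dec P) → 𝟙 d ≡ 0ℚ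
𝟙-no ¬p (yes p) = ⊥-elim (¬p p)
𝟙-no _ (no _) = refl

∑-𝟙-≡ : ∀ {N} (i : Fin N) → sum (λ j → 𝟙 (j Finₚ.≟ i)) ≡ 1ℚ
∑-𝟙-≡ i = trans (∑-point (λ j → 𝟙 (j Finₚ.≟ i)) i (λ j j≢i → 𝟙-no j≢i (j Finₚ.≟ i))) (𝟙-yes refl (i Finₚ.≟ i))

κ : ℕ → ℚ
κ N = sum (λ (_ : Fin N) → 1ℚ) ℚ.- 1ℚ

∑-ordered-pairs : ∀ {N} (I : Fin N → Fin N → ℚ) (f : Fin N → ℚ) →
  (∀ i j → I i j ℚ.+ I j i ℚ.+ 𝟙 (j Finₚ.≟ i) ≡ 1ℚ) →
  sum (λ i → sum (λ j → I i j ℚ.* (f i ℚ.+ f j))) ≡ κ N ℚ.* sum f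
∑-ordered-pairs {N} I f total = begin
  sum (λ i → sum (λ j → I i j ℚ.* (f i ℚ.+ f j)))
    ≡⟨ sum-cong-≗ (λ i → sum-cong-≗ (λ j → ℚₚ.*-distribˡ-+ (I i j) (f i) (f j))) ⟩
  sum (λ i → sum (λ j → I i j ℚ.* f i ℚ.+ I i j ℚ.* f j))
    ≡⟨ ∑∑-distrib-+ (λ i j → I i j ℚ.* f i) (λ i j → I i j ℚ.* f j) ⟩
  sum (λ i → sum (λ j → I i j ℚ.* f i)) ℚ.+ sum (λ i → sum (λ j → I i j ℚ.* f j))
    ≡⟨ cong (sum (λ i → sum (λ j → I i j ℚ.* f i)) ℚ.+_) (∑-comm (λ i j → I i j ℚ.* f j)) ⟩
  sum (λ i → sum (λ j → I i j ℚ.* f i)) ℚ.+ sum (λ i → sum (λ j → I j i ℚ.* f i))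
    ≡⟨ ∑∑-distrib-+ (λ i j → I i j ℚ.* f i) (λ i j → I j i ℚ.* f i) ⟨
  sum (λ i → sum (λ j → I i j ℚ.* f i ℚ.+ I j i ℚ.* f i))
    ≡⟨ sum-cong-≗ (λ i → trans (sum-cong-≗ (λ j → sym (ℚₚ.*-distribʳ-+ (f i) (I i j) (I j i))))
                               (sym (*-distribʳ-sum (f i) (λ j → I i j ℚ.+ I j i)))) ⟩
  sum (λ i → sum (λ j → I i j ℚ.+ I j i) ℚ.* f i)
    ≡⟨ sum-cong-≗ (λ i → cong (ℚ._* f i) (row-sum i)) ⟩
  sum (λ i → κ N ℚ.* f i)
    ≡⟨ *-distribˡ-sum (κ N) f ⟨
  κ N ℚ.* sum f ∎
  where
  open ≡-Reasoning
  x≡x+1-1 : ∀ x → x ≡ x ℚ.+ 1ℚ ℚ.- 1ℚ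
  x≡x+1-1 = solve-∀ ℚ-ring
  row-sum : ∀ i → sum (λ j → I i j ℚ.+ I j i) ≡ κ N
  row-sum i = begin
    sum (λ j → I i j ℚ.+ I j i)
      ≡⟨ x≡x+1-1 _ ⟩
    sum (λ j → I i j ℚ.+ I j i) ℚ.+ 1ℚ ℚ.- 1ℚ
      ≡⟨ cong (λ z → sum (λ j → I i j ℚ.+ I j i) ℚ.+ z ℚ.- 1ℚ) (∑-𝟙-≡ i) ⟨
    sum (λ j → I i j ℚ.+ I j i) ℚ.+ sum (λ j → 𝟙 (j Finₚ.≟ i)) ℚ.- 1ℚ
      ≡⟨ cong (ℚ._- 1ℚ) (∑-distrib-+ (λ j → I i j ℚ.+ I j i) (λ j → 𝟙 (j Finₚ.≟ i))) ⟨
    sum (λ j → I i j ℚ.+ I j i ℚ.+ 𝟙 (j Finₚ.≟ i)) ℚ.- 1ℚ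
      ≡⟨ cong (ℚ._- 1ℚ) (sum-cong-≗ (total i)) ⟩
    κ N ∎


∑-ordered-pairs-edges : ∀ {N} (I : Fin N → Fin N → ℚ) (f : Fin N → ℚ) (g : Fin N → Fin N → ℚ) →
  (∀ i j → I i j ℚ.+ I j i ℚ.+ 𝟙 (j Finₚ.≟ i) ≡ 1ℚ) →
  sum (λ i → sum (λ j → I i j ℚ.* (f i ℚ.- g i j ℚ.+ (f j ℚ.- g i j)))) ≡
  κ N ℚ.* sum f ℚ.- two ℚ.* sum (λ i → sum (λ j → I i j ℚ.* g i j))
∑-ordered-pairs-edges {N} I f g total = begin
  sum (λ i → sum (λ j → I i j ℚ.* (f i ℚ.- g i j ℚ.+ (f j ℚ.- g i j))))
    ≡⟨ sum-cong-≗ (λ i → sum-cong-≗ (λ j → split (I i j) (f i) (f j) (g i j))) ⟩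
  sum (λ i → sum (λ j → I i j ℚ.* (f i ℚ.+ f j) ℚ.+ ℚ.- two ℚ.* (I i j ℚ.* g i j)))
    ≡⟨ ∑∑-distrib-+ (λ i j → I i j ℚ.* (f i ℚ.+ f j)) (λ i j → ℚ.- two ℚ.* (I i j ℚ.* g i j)) ⟩
  sum (λ i → sum (λ j → I i j ℚ.* (f i ℚ.+ f j))) ℚ.+ sum (λ i → sum (λ j → ℚ.- two ℚ.* (I i j ℚ.* g i j)))
    ≡⟨ cong₂ ℚ._+_ (∑-ordered-pairs I f total) (∑∑-scale (ℚ.- two) (λ i j → I i j ℚ.* g i j)) ⟩
  κ N ℚ.* sum f ℚ.+ ℚ.- two ℚ.* sum (λ i → sum (λ j → I i j ℚ.* g i j))
    ≡⟨ cong (κ N ℚ.* sum f ℚ.+_) (ℚₚ.neg-distribˡ-* two (sum (λ i → sum (λ j → I i j ℚ.* g i j)))) ⟨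
  κ N ℚ.* sum f ℚ.- two ℚ.* sum (λ i → sum (λ j → I i j ℚ.* g i j)) ∎
  where
  open ≡-Reasoning
  split : ∀ i a b c → i ℚ.* (a ℚ.- c ℚ.+ (b ℚ.- c)) ≡ i ℚ.* (a ℚ.+ b) ℚ.+ ℚ.- two ℚ.* (i ℚ.* c)
  split = solve-∀ ℚ-ring


Key : Set
Key = ℕ × ℕ

keyOrder : StrictTotalOrder _ _ _
keyOrder = ×-strictTotalOrder ℕₚ.<-strictTotalOrder ℕₚ.<-strictTotalOrder

_≺_ : Key → Key → Set
_≺_ = ×-Lex _≡_ ℕ._<_ ℕ._<_

≺-trans : ∀ {f g h} → f ≺ g → g ≺ h → f ≺ h
≺-trans = StrictTotalOrder.trans keyOrder

≺-irrefl : ∀ {g} → ¬ g ≺ g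
≺-irrefl = StrictTotalOrder.irrefl keyOrder (refl , refl)

≺-asym : ∀ {g h} → g ≺ h → ¬ h ≺ g
≺-asym p q = ≺-irrefl (≺-trans p q)

compareKey : ∀ g h → Tri (g ≺ h) (g ≡ h) (h ≺ g)
compareKey g h with StrictTotalOrder.compare keyOrder g h
... | tri< p ¬q ¬r = tri< p (¬q ∘ ≡⇒≡×≡) ¬r
... | tri≈ ¬p q ¬r = tri≈ ¬p (≡×≡⇒≡ q) ¬r
... | tri> ¬p ¬q r = tri> ¬p (¬q ∘ ≡⇒≡×≡) r

_≺?_ : Decidable _≺_
_≺?_ = StrictTotalOrder._<?_ keyOrder

≡ᵇ-reflects : ∀ m n → Reflects (m ≡ n) (m ℕ.≡ᵇ n)
≡ᵇ-reflects m n = fromEquivalence (ℕₚ.≡ᵇ⇒≡ m n) (ℕₚ.≡⇒≡ᵇ m n)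

<K-reflects : ∀ g h → Reflects (g ≺ h) (g <K h)
<K-reflects (a , b) (c , d) = ℕₚ.<ᵇ-reflects-< a c ⊎-reflects (≡ᵇ-reflects a c ×-reflects ℕₚ.<ᵇ-reflects-< b d)

=K-reflects : ∀ g h → Reflects (proj₁ g ≡ proj₁ h × proj₂ g ≡ proj₂ h) (g =K h)
=K-reflects (a , b) (c , d) = ≡ᵇ-reflects a c ×-reflects ≡ᵇ-reflects b d

_≺ʰ_ : Key → List Key → Set
g ≺ʰ t = Connected _≺_ (just g) (head t)

_≺ʰ?_ : ∀ g t → Dec (g ≺ʰ t)
g ≺ʰ? t = connected? _≺?_ (just g) (head t)

≺ʰ-trans : ∀ {f g} t → f ≺ g → g ≺ʰ t → f ≺ʰ t
≺ʰ-trans [] _ _ = just-nothing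
≺ʰ-trans (_ ∷ _) f≺g (just g≺h) = just (≺-trans f≺g g≺h)

Sorted : List Key → Set
Sorted = Linked _≺_


SignedMonomial : Set
SignedMonomial = Maybe (ℚ × List Key)

PreservesSorted : (List Key → SignedMonomial) → Set
PreservesSorted f = ∀ S {s T} → Sorted S → f S ≡ just (s , T) → Sorted T

negCons : Key → SignedMonomial → SignedMonomial
negCons h nothing = nothing
negCons h (just (s , T)) = just (ℚ.- s , h ∷ T)

insertK-≺ : ∀ {g h} t → g ≺ h → insertK g (h ∷ t) ≡ just (1ℚ , g ∷ h ∷ t)
insertK-≺ {g} {h} t g≺h rewrite det (<K-reflects g h) (ofʸ g≺h) = refl

insertK-≡ : ∀ g t → insertK g (g ∷ t) ≡ nothing
insertK-≡ g t rewrite det (<K-reflects g g) (ofⁿ ≺-irrefl) | det (=K-reflects g g) (ofʸ (refl , refl)) = refl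

insertK-≻ : ∀ {g h} t → h ≺ g → insertK g (h ∷ t) ≡ negCons h (insertK g t)
insertK-≻ {g} {h} t h≺g
  rewrite det (<K-reflects g h) (ofⁿ (≺-asym h≺g))
        | det (=K-reflects g h) (ofⁿ (λ g≈h → ≺-irrefl (subst (h ≺_) (≡×≡⇒≡ g≈h) h≺g)))
  with insertK g t
... | nothing = refl
... | just _ = refl

insertK-head : ∀ {g} T → g ≺ʰ T → insertK g T ≡ just (1ℚ , g ∷ T)
insertK-head [] _ = refl
insertK-head (h ∷ t) (just g≺h) = insertK-≺ t g≺h

popHead : ∀ {g} t → Dec (g ≺ʰ t) → SignedMonomial
popHead t (yes _) = just (1ℚ , t)
popHead t (no _) = nothing

-- The inverse of insertK g; the test at the head makes it exact on unsorted lists too.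
remove : Key → List Key → SignedMonomial
remove g [] = nothing
remove g (h ∷ t) with compareKey g h
... | tri< _ _ _ = nothing
... | tri≈ _ _ _ = popHead t (g ≺ʰ? t)
... | tri> _ _ _ = negCons h (remove g t)

remove-at-head : ∀ g t → remove g (g ∷ t) ≡ popHead t (g ≺ʰ? t)
remove-at-head g t with compareKey g g
... | tri< g≺g _ _ = ⊥-elim (≺-irrefl g≺g)
... | tri≈ _ _ _ = refl
... | tri> _ _ g≺g = ⊥-elim (≺-irrefl g≺g)

remove-≺ : ∀ {g h} t → g ≺ h → remove g (h ∷ t) ≡ nothing
remove-≺ {g} {h} t g≺h with compareKey g h
... | tri< _ _ _ = refl
... | tri≈ ¬g≺h _ _ = ⊥-elim (¬g≺h g≺h)
... | tri> ¬g≺h _ _ = ⊥-elim (¬g≺h g≺h)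

remove-head : ∀ g t → g ≺ʰ t → remove g (g ∷ t) ≡ just (1ℚ , t)
remove-head g t g≺ʰt rewrite remove-at-head g t with g ≺ʰ? t
... | yes _ = refl
... | no ¬g≺ʰt = ⊥-elim (¬g≺ʰt g≺ʰt)

remove-≻ : ∀ {g h} t → h ≺ g → remove g (h ∷ t) ≡ negCons h (remove g t)
remove-≻ {g} {h} t h≺g with compareKey g h
... | tri< _ _ ¬h≺g = ⊥-elim (¬h≺g h≺g)
... | tri≈ _ _ ¬h≺g = ⊥-elim (¬h≺g h≺g)
... | tri> _ _ _ = refl

remove-≺ʰ : ∀ {g} t → g ≺ʰ t → remove g t ≡ nothing
remove-≺ʰ [] _ = refl
remove-≺ʰ (_ ∷ t) (just g≺h) = remove-≺ t g≺h

remove⇒insertK : ∀ g S {s T} → remove g S ≡ just (s , T) → insertK g T ≡ just (s , S)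
remove⇒insertK g (h ∷ t) p with compareKey g h
... | tri≈ _ refl _ with g ≺ʰ? t | p
...   | yes g≺ʰt | refl = insertK-head t g≺ʰt
remove⇒insertK g (h ∷ t) p | tri> _ _ h≺g with remove g t in eq | p
... | just (_ , T) | refl rewrite insertK-≻ T h≺g | remove⇒insertK g t eq = refl

insertK⇒remove : ∀ g T {s S} → insertK g T ≡ just (s , S) → remove g S ≡ just (s , T)
insertK⇒remove g [] refl = remove-head g [] just-nothing
insertK⇒remove g (h ∷ t) p with compareKey g h
... | tri< g≺h _ _ rewrite insertK-≺ t g≺h with p
...   | refl = remove-head g (h ∷ t) (just g≺h)
insertK⇒remove g (h ∷ t) p | tri≈ _ refl _ rewrite insertK-≡ g t with p
... | ()
insertK⇒remove g (h ∷ t) p | tri> _ _ h≺g rewrite insertK-≻ t h≺g with insertK g t in eq | p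
... | just (_ , S′) | refl rewrite remove-≻ S′ h≺g | insertK⇒remove g t eq = refl

≺ʰ-insertK : ∀ {h g} t {s S} → h ≺ʰ t → h ≺ g → insertK g t ≡ just (s , S) → h ≺ʰ S
≺ʰ-insertK [] _ h≺g refl = just h≺g
≺ʰ-insertK {h} {g} (x ∷ t) h≺ʰt h≺g p with compareKey g x
... | tri< g≺x _ _ rewrite insertK-≺ t g≺x with p
...   | refl = just h≺g
≺ʰ-insertK {h} {g} (x ∷ t) h≺ʰt h≺g p | tri≈ _ refl _ rewrite insertK-≡ g t with p
... | ()
≺ʰ-insertK {h} {g} (x ∷ t) h≺ʰt h≺g p | tri> _ _ x≺g rewrite insertK-≻ t x≺g with insertK g t | p
... | just _ | refl = h≺ʰt

insertK-sorted : ∀ g → PreservesSorted (insertK g)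
insertK-sorted g [] _ refl = [-]
insertK-sorted g (x ∷ t) sorted p with compareKey g x
... | tri< g≺x _ _ rewrite insertK-≺ t g≺x with p
...   | refl = g≺x ∷ sorted
insertK-sorted g (x ∷ t) sorted p | tri≈ _ refl _ rewrite insertK-≡ g t with p
... | ()
insertK-sorted g (x ∷ t) sorted p | tri> _ _ x≺g rewrite insertK-≻ t x≺g with insertK g t in eq | p
... | just _ | refl = ≺ʰ-insertK t (head′ sorted) x≺g eq ∷′ insertK-sorted g t (Linked.tail sorted) eq

≺ʰ-remove : ∀ {h g} t {s T} → h ≺ʰ t → remove g t ≡ just (s , T) → h ≺ʰ T
≺ʰ-remove {h} {g} (x ∷ t) h≺ʰt p with compareKey g x
... | tri≈ _ refl _ with g ≺ʰ? t | p | h≺ʰt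
...   | yes g≺ʰt | refl | just h≺g = ≺ʰ-trans t h≺g g≺ʰt
≺ʰ-remove {h} {g} (x ∷ t) h≺ʰt p | tri> _ _ _ with remove g t | p
... | just _ | refl = h≺ʰt

≺ʰ-remove⁻ : ∀ {g h} t {s T} → g ≺ h → remove h t ≡ just (s , T) → g ≺ʰ T → g ≺ʰ t
≺ʰ-remove⁻ {g} {h} (y ∷ t) g≺h p g≺ʰT with compareKey h y
... | tri≈ _ refl _ = just g≺h
... | tri> _ _ _ with remove h t | p
...   | just _ | refl = g≺ʰT

remove-sorted : ∀ g → PreservesSorted (remove g)
remove-sorted g (x ∷ t) sorted p with compareKey g x
... | tri≈ _ refl _ with g ≺ʰ? t | p
...   | yes _ | refl = Linked.tail sorted
remove-sorted g (x ∷ t) sorted p | tri> _ _ _ with remove g t in eq | p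
... | just _ | refl = ≺ʰ-remove t (head′ sorted) eq ∷′ remove-sorted g t (Linked.tail sorted) eq

insertK-sign² : ∀ g T {s S} → insertK g T ≡ just (s , S) → s ℚ.* s ≡ 1ℚ
insertK-sign² g [] refl = refl
insertK-sign² g (x ∷ t) p with compareKey g x
... | tri< g≺x _ _ rewrite insertK-≺ t g≺x with p
...   | refl = refl
insertK-sign² g (x ∷ t) p | tri≈ _ refl _ rewrite insertK-≡ g t with p
... | ()
insertK-sign² g (x ∷ t) p | tri> _ _ x≺g rewrite insertK-≻ t x≺g with insertK g t in eq | p
... | just (s , _) | refl = trans (neg*neg s s) (insertK-sign² g t eq)

remove⇒insertK-nothing : ∀ g S {s T} → remove g S ≡ just (s , T) → insertK g S ≡ nothing
remove⇒insertK-nothing g (x ∷ t) p with compareKey g x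
... | tri≈ _ refl _ = insertK-≡ g t
remove⇒insertK-nothing g (x ∷ t) p | tri> _ _ x≺g with remove g t in eq | p
... | just _ | refl rewrite insertK-≻ t x≺g | remove⇒insertK-nothing g t eq = refl

remove-nothing⇒insertK : ∀ g S → Sorted S → remove g S ≡ nothing → Σ (ℚ × List Key) λ r → insertK g S ≡ just r
remove-nothing⇒insertK g [] _ _ = _ , refl
remove-nothing⇒insertK g (x ∷ t) sorted p with compareKey g x
... | tri< g≺x _ _ = _ , insertK-≺ t g≺x
... | tri≈ _ refl _ with g ≺ʰ? t | p
...   | yes _ | ()
...   | no ¬g≺ʰt | _ = ⊥-elim (¬g≺ʰt (head′ sorted))
remove-nothing⇒insertK g (x ∷ t) sorted p | tri> _ _ x≺g with remove g t in eq | p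
...   | nothing | _ with remove-nothing⇒insertK g t (Linked.tail sorted) eq
...     | _ , eq′ rewrite insertK-≻ t x≺g | eq′ = _ , refl

scale : ℚ → SignedMonomial → SignedMonomial
scale s nothing = nothing
scale s (just (s′ , T)) = just (s ℚ.* s′ , T)

infixl 1 _>>=ˢ_
_>>=ˢ_ : SignedMonomial → (List Key → SignedMonomial) → SignedMonomial
nothing >>=ˢ f = nothing
just (s , T) >>=ˢ f = scale s (f T)

negate : SignedMonomial → SignedMonomial
negate nothing = nothing
negate (just (s , T)) = just (ℚ.- s , T)

cons : Key → SignedMonomial → SignedMonomial
cons h nothing = nothing
cons h (just (s , T)) = just (s , h ∷ T)

negCons->>=ˢ : ∀ x m f f′ → (∀ T → f (x ∷ T) ≡ negCons x (f′ T)) → (negCons x m >>=ˢ f) ≡ cons x (m >>=ˢ f′)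
negCons->>=ˢ x nothing f f′ h = refl
negCons->>=ˢ x (just (s , T)) f f′ h rewrite h T with f′ T
... | nothing = refl
... | just (s′ , T′) = cong (λ r → just (r , x ∷ T′)) (neg*neg s s′)

negate-cons : ∀ x m → negate (cons x m) ≡ cons x (negate m)
negate-cons x nothing = refl
negate-cons x (just _) = refl

negate-involutive : ∀ m → negate (negate m) ≡ m
negate-involutive nothing = refl
negate-involutive (just (s , T)) = cong (λ r → just (r , T)) (neg-involutive s)

negate-swap : ∀ {m m′} → m ≡ negate m′ → m′ ≡ negate m
negate-swap {m′ = m′} refl = sym (negate-involutive m′)

negCons->>=ˢ-remove : ∀ {g} x m → x ≺ g → (negCons x m >>=ˢ remove g) ≡ cons x (m >>=ˢ remove g)
negCons->>=ˢ-remove x m x≺g = negCons->>=ˢ x m (remove _) (remove _) (λ T → remove-≻ T x≺g)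

remove-after-≺ : ∀ {g x} h t → g ≺ x → (remove h (x ∷ t) >>=ˢ remove g) ≡ nothing
remove-after-≺ {g} {x} h t g≺x with compareKey h x
... | tri< _ _ _ = refl
... | tri≈ _ refl _ with h ≺ʰ? t
...   | yes h≺ʰt rewrite remove-≺ʰ t (≺ʰ-trans t g≺x h≺ʰt) = refl
...   | no _ = refl
remove-after-≺ {g} {x} h t g≺x | tri> _ _ _ with remove h t
...   | nothing = refl
...   | just (_ , T) rewrite remove-≺ T g≺x = refl

remove-head-anticomm : ∀ g h t → g ≺ h → (remove g (g ∷ t) >>=ˢ remove h) ≡ negate (remove h (g ∷ t) >>=ˢ remove g)
remove-head-anticomm g h t g≺h rewrite remove-≻ t g≺h | remove-at-head g t with g ≺ʰ? t | remove h t in eq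
... | yes _ | nothing rewrite eq = refl
... | yes g≺ʰt | just (s , T) rewrite eq | remove-head g T (≺ʰ-remove t g≺ʰt eq) =
  cong (λ r → just (r , T)) (sign-flip s)
  where
  sign-flip : ∀ s → 1ℚ ℚ.* s ≡ ℚ.- (ℚ.- s ℚ.* 1ℚ)
  sign-flip = solve-∀ ℚ-ring
... | no _ | nothing = refl
... | no ¬g≺ʰt | just (s , T) rewrite remove-at-head g T with g ≺ʰ? T
...   | yes g≺ʰT = ⊥-elim (¬g≺ʰt (≺ʰ-remove⁻ t g≺h eq g≺ʰT))
...   | no _ = refl

remove-twice : ∀ g S → (remove g S >>=ˢ remove g) ≡ nothing
remove-twice g [] = refl
remove-twice g (x ∷ t) with compareKey g x
... | tri< _ _ _ = refl
... | tri≈ _ refl _ with g ≺ʰ? t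
...   | yes g≺ʰt rewrite remove-≺ʰ t g≺ʰt = refl
...   | no _ = refl
remove-twice g (x ∷ t) | tri> _ _ x≺g rewrite negCons->>=ˢ-remove x (remove g t) x≺g | remove-twice g t = refl

remove-anticomm : ∀ g h S → (remove g S >>=ˢ remove h) ≡ negate (remove h S >>=ˢ remove g)
remove-anticomm g h [] = refl
remove-anticomm g h (x ∷ t) = by-cases (compareKey g x) (compareKey h x)
  where
  open ≡-Reasoning
  by-cases : Tri (g ≺ x) (g ≡ x) (x ≺ g) → Tri (h ≺ x) (h ≡ x) (x ≺ h) →
             (remove g (x ∷ t) >>=ˢ remove h) ≡ negate (remove h (x ∷ t) >>=ˢ remove g)
  by-cases (tri< g≺x _ _) _ rewrite remove-≺ t g≺x | remove-after-≺ h t g≺x = refl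
  by-cases _ (tri< h≺x _ _) rewrite remove-≺ t h≺x | remove-after-≺ g t h≺x = refl
  by-cases (tri≈ _ g≡x _) (tri≈ _ h≡x _) rewrite g≡x | h≡x | remove-twice x (x ∷ t) = refl
  by-cases (tri≈ _ g≡x _) (tri> _ _ x≺h) rewrite sym g≡x = remove-head-anticomm g h t x≺h
  by-cases (tri> _ _ x≺g) (tri≈ _ h≡x _) rewrite sym h≡x = negate-swap (remove-head-anticomm h g t x≺g)
  by-cases (tri> _ _ x≺g) (tri> _ _ x≺h) = begin
    (remove g (x ∷ t) >>=ˢ remove h)              ≡⟨ cong (_>>=ˢ remove h) (remove-≻ t x≺g) ⟩
    (negCons x (remove g t) >>=ˢ remove h)         ≡⟨ negCons->>=ˢ-remove x (remove g t) x≺h ⟩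
    cons x (remove g t >>=ˢ remove h)              ≡⟨ cong (cons x) (remove-anticomm g h t) ⟩
    cons x (negate (remove h t >>=ˢ remove g))     ≡⟨ negate-cons x _ ⟨
    negate (cons x (remove h t >>=ˢ remove g))     ≡⟨ cong negate (negCons->>=ˢ-remove x (remove h t) x≺g) ⟨
    negate (negCons x (remove h t) >>=ˢ remove g)  ≡⟨ cong (λ m → negate (m >>=ˢ remove g)) (remove-≻ t x≺h) ⟨
    negate (remove h (x ∷ t) >>=ˢ remove g)        ∎

insertK-remove-anticomm-front : ∀ k g S → k ≢ g → k ≺ʰ S →
  (insertK k S >>=ˢ remove g) ≡ negate (remove g S >>=ˢ insertK k)
insertK-remove-anticomm-front k g S k≢g k≺ʰS rewrite insertK-head S k≺ʰS with compareKey g k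
... | tri< g≺k _ _ rewrite remove-≺ʰ S (≺ʰ-trans S g≺k k≺ʰS) = refl
... | tri≈ _ g≡k _ = ⊥-elim (k≢g (sym g≡k))
... | tri> _ _ _ with remove g S in eq
...   | nothing = refl
...   | just (s , T) rewrite insertK-head T (≺ʰ-remove S k≺ʰS eq) = cong (λ r → just (r , k ∷ T)) (sign-flip s)
  where
  sign-flip : ∀ s → 1ℚ ℚ.* ℚ.- s ≡ ℚ.- (s ℚ.* 1ℚ)
  sign-flip = solve-∀ ℚ-ring

insertK-remove-anticomm : ∀ k g S → k ≢ g → Sorted S →
  (insertK k S >>=ˢ remove g) ≡ negate (remove g S >>=ˢ insertK k)
insertK-remove-anticomm k g [] k≢g _ = insertK-remove-anticomm-front k g [] k≢g just-nothing
insertK-remove-anticomm k g (x ∷ t) k≢g sorted = by-cases (compareKey k x) (compareKey g x)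
  where
  open ≡-Reasoning
  goal : Set
  goal = (insertK k (x ∷ t) >>=ˢ remove g) ≡ negate (remove g (x ∷ t) >>=ˢ insertK k)
  by-cases : Tri (k ≺ x) (k ≡ x) (x ≺ k) → Tri (g ≺ x) (g ≡ x) (x ≺ g) → goal
  by-cases (tri< k≺x _ _) _ = insertK-remove-anticomm-front k g (x ∷ t) k≢g (just k≺x)
  by-cases (tri≈ _ k≡x _) (tri< g≺x _ _) rewrite sym k≡x | insertK-≡ k t | remove-≺ t g≺x = refl
  by-cases (tri≈ _ k≡x _) (tri≈ _ g≡x _) = ⊥-elim (k≢g (trans k≡x (sym g≡x)))
  by-cases (tri≈ _ k≡x _) (tri> _ _ x≺g) rewrite sym k≡x | insertK-≡ k t | remove-≻ t x≺g with remove g t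
  ... | nothing = refl
  ... | just (_ , T) rewrite insertK-≡ k T = refl
  by-cases (tri> _ _ x≺k) (tri< g≺x _ _) rewrite insertK-≻ t x≺k | remove-≺ t g≺x with insertK k t
  ... | nothing = refl
  ... | just (_ , S′) rewrite remove-≺ S′ g≺x = refl
  by-cases (tri> _ _ x≺k) (tri≈ _ g≡x _) rewrite g≡x | insertK-≻ t x≺k | remove-head x t (head′ sorted) with insertK k t in eq
  ... | nothing = refl
  ... | just (s , S′) rewrite remove-head x S′ (≺ʰ-insertK t (head′ sorted) x≺k eq) = cong (λ r → just (r , S′)) (sign-flip s)
    where
    sign-flip : ∀ s → ℚ.- s ℚ.* 1ℚ ≡ ℚ.- (1ℚ ℚ.* s)
    sign-flip = solve-∀ ℚ-ring
  by-cases (tri> _ _ x≺k) (tri> _ _ x≺g) = begin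
    (insertK k (x ∷ t) >>=ˢ remove g)
      ≡⟨ cong (_>>=ˢ remove g) (insertK-≻ t x≺k) ⟩
    (negCons x (insertK k t) >>=ˢ remove g)
      ≡⟨ negCons->>=ˢ-remove x (insertK k t) x≺g ⟩
    cons x (insertK k t >>=ˢ remove g)
      ≡⟨ cong (cons x) (insertK-remove-anticomm k g t k≢g (Linked.tail sorted)) ⟩
    cons x (negate (remove g t >>=ˢ insertK k))
      ≡⟨ negate-cons x _ ⟨
    negate (cons x (remove g t >>=ˢ insertK k))
      ≡⟨ cong negate (negCons->>=ˢ x (remove g t) (insertK k) (insertK k) (λ T → insertK-≻ T x≺k)) ⟨
    negate (negCons x (remove g t) >>=ˢ insertK k)
      ≡⟨ cong (λ m → negate (m >>=ˢ insertK k)) (remove-≻ t x≺g) ⟨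
    negate (remove g (x ∷ t) >>=ˢ insertK k) ∎


-- An element is represented by its coefficient function on key lists. Coefficient functions
-- of elements vanish off sorted lists, so they are only compared on sorted ones.
Coeffs : Set
Coeffs = List Key → ℚ

infix 4 _≈ˢ_
record _≈ˢ_ (F G : Coeffs) : Set where
  constructor mk≈ˢ
  field
    at : ∀ S → Sorted S → F S ≡ G S
open _≈ˢ_ public

≈ˢ-setoid : Setoid _ _
≈ˢ-setoid = record
  { Carrier = Coeffs
  ; _≈_ = _≈ˢ_
  ; isEquivalence = record
    { refl = mk≈ˢ λ _ _ → refl
    ; sym = λ p → mk≈ˢ λ S s → sym (at p S s)
    ; trans = λ p q → mk≈ˢ λ S s → trans (at p S s) (at q S s)
    }
  }

module ≈ˢ-Reasoning = SetoidReasoning ≈ˢ-setoid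

≈ˢ-refl : ∀ {F} → F ≈ˢ F
≈ˢ-refl = Setoid.refl ≈ˢ-setoid

≈ˢ-sym : ∀ {F G} → F ≈ˢ G → G ≈ˢ F
≈ˢ-sym = Setoid.sym ≈ˢ-setoid

≈ˢ-trans : ∀ {F G H} → F ≈ˢ G → G ≈ˢ H → F ≈ˢ H
≈ˢ-trans = Setoid.trans ≈ˢ-setoid

pointwise : ∀ {F G : Coeffs} → (∀ S → F S ≡ G S) → F ≈ˢ G
pointwise p = mk≈ˢ λ S _ → p S

0ᶜ : Coeffs
0ᶜ _ = 0ℚ

infixl 6 _+ᶜ_ _-ᶜ_
infixl 7 _·ᶜ_
infix 8 -ᶜ_

_+ᶜ_ : Coeffs → Coeffs → Coeffs
(F +ᶜ G) S = F S ℚ.+ G S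

_·ᶜ_ : ℚ → Coeffs → Coeffs
(α ·ᶜ F) S = α ℚ.* F S

-ᶜ_ : Coeffs → Coeffs
(-ᶜ F) S = ℚ.- F S

_-ᶜ_ : Coeffs → Coeffs → Coeffs
F -ᶜ G = F +ᶜ -ᶜ G

∑ᶜ : ∀ {N} → (Fin N → Coeffs) → Coeffs
∑ᶜ Fs S = sum (λ i → Fs i S)

+ᶜ-cong : ∀ {F F′ G G′} → F ≈ˢ F′ → G ≈ˢ G′ → F +ᶜ G ≈ˢ F′ +ᶜ G′
+ᶜ-cong p q = mk≈ˢ λ S s → cong₂ ℚ._+_ (at p S s) (at q S s)

+ᶜ-congˡ : ∀ F {G G′} → G ≈ˢ G′ → F +ᶜ G ≈ˢ F +ᶜ G′
+ᶜ-congˡ F q = mk≈ˢ λ S s → cong (F S ℚ.+_) (at q S s)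

+ᶜ-congʳ : ∀ {F F′} G → F ≈ˢ F′ → F +ᶜ G ≈ˢ F′ +ᶜ G
+ᶜ-congʳ G p = mk≈ˢ λ S s → cong (ℚ._+ G S) (at p S s)

-ᶜ-cong₂ : ∀ {F F′ G G′} → F ≈ˢ F′ → G ≈ˢ G′ → F -ᶜ G ≈ˢ F′ -ᶜ G′
-ᶜ-cong₂ p q = mk≈ˢ λ S s → cong₂ (λ x y → x ℚ.- y) (at p S s) (at q S s)

·ᶜ-cong : ∀ α {F G} → F ≈ˢ G → α ·ᶜ F ≈ˢ α ·ᶜ G
·ᶜ-cong α p = mk≈ˢ λ S s → cong (α ℚ.*_) (at p S s)

-ᶜ-cong : ∀ {F G} → F ≈ˢ G → -ᶜ F ≈ˢ -ᶜ G
-ᶜ-cong p = mk≈ˢ λ S s → cong ℚ.-_ (at p S s)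

∑ᶜ-cong : ∀ {N} {Fs Gs : Fin N → Coeffs} → (∀ i → Fs i ≈ˢ Gs i) → ∑ᶜ Fs ≈ˢ ∑ᶜ Gs
∑ᶜ-cong p = mk≈ˢ λ S s → sum-cong-≗ (λ i → at (p i) S s)

Op : Set
Op = Coeffs → Coeffs

record LinearOp (op : Op) : Set where
  field
    ≈ˢ-cong : ∀ {F G} → F ≈ˢ G → op F ≈ˢ op G
    +-hom : ∀ F G → op (F +ᶜ G) ≈ˢ op F +ᶜ op G
    ·-hom : ∀ α F → op (α ·ᶜ F) ≈ˢ α ·ᶜ op F

  open ≈ˢ-Reasoning

  0-hom : op 0ᶜ ≈ˢ 0ᶜ
  0-hom = mk≈ˢ λ S s → trans (at (·-hom 0ℚ 0ᶜ) S s) (ℚₚ.*-zeroˡ (op 0ᶜ S))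

  -‿hom : ∀ F → op (-ᶜ F) ≈ˢ -ᶜ op F
  -‿hom F = begin
    op (-ᶜ F)              ≈⟨ ≈ˢ-cong (pointwise λ S → neg≡-1* (F S)) ⟩
    op ((ℚ.- 1ℚ) ·ᶜ F)     ≈⟨ ·-hom (ℚ.- 1ℚ) F ⟩
    (ℚ.- 1ℚ) ·ᶜ op F       ≈⟨ pointwise (λ S → neg≡-1* (op F S)) ⟨
    -ᶜ op F                ∎
    where
    neg≡-1* : ∀ a → ℚ.- a ≡ ℚ.- 1ℚ ℚ.* a
    neg≡-1* = solve-∀ ℚ-ring

  -‿hom₂ : ∀ F G → op (F -ᶜ G) ≈ˢ op F -ᶜ op G
  -‿hom₂ F G = begin
    op (F -ᶜ G)           ≈⟨ +-hom F (-ᶜ G) ⟩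
    op F +ᶜ op (-ᶜ G)     ≈⟨ +ᶜ-congˡ (op F) (-‿hom G) ⟩
    op F -ᶜ op G          ∎

  ∑-hom : ∀ {N} (Fs : Fin N → Coeffs) → op (∑ᶜ Fs) ≈ˢ ∑ᶜ (op ∘ Fs)
  ∑-hom {zero} Fs = 0-hom
  ∑-hom {suc N} Fs = begin
    op (Fs Fin.zero +ᶜ ∑ᶜ (Fs ∘ Fin.suc))           ≈⟨ +-hom (Fs Fin.zero) (∑ᶜ (Fs ∘ Fin.suc)) ⟩
    op (Fs Fin.zero) +ᶜ op (∑ᶜ (Fs ∘ Fin.suc))      ≈⟨ +ᶜ-congˡ (op (Fs Fin.zero)) (∑-hom (Fs ∘ Fin.suc)) ⟩
    ∑ᶜ (op ∘ Fs)                                    ∎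

id-linear : LinearOp (λ F → F)
id-linear = record
  { ≈ˢ-cong = λ p → p
  ; +-hom = λ _ _ → ≈ˢ-refl
  ; ·-hom = λ _ _ → ≈ˢ-refl
  }

0-linear : LinearOp (λ _ → 0ᶜ)
0-linear = record
  { ≈ˢ-cong = λ _ → ≈ˢ-refl
  ; +-hom = λ _ _ → pointwise λ _ → refl
  ; ·-hom = λ α _ → pointwise λ _ → sym (ℚₚ.*-zeroʳ α)
  }

∘-linear : ∀ {op₁ op₂} → LinearOp op₁ → LinearOp op₂ → LinearOp (op₁ ∘ op₂)
∘-linear L₁ L₂ = record
  { ≈ˢ-cong = L₁.≈ˢ-cong ∘ L₂.≈ˢ-cong
  ; +-hom = λ F G → ≈ˢ-trans (L₁.≈ˢ-cong (L₂.+-hom F G)) (L₁.+-hom _ _)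
  ; ·-hom = λ α F → ≈ˢ-trans (L₁.≈ˢ-cong (L₂.·-hom α F)) (L₁.·-hom α _)
  }
  where
  module L₁ = LinearOp L₁
  module L₂ = LinearOp L₂

+-linear : ∀ {op₁ op₂} → LinearOp op₁ → LinearOp op₂ → LinearOp (λ F → op₁ F +ᶜ op₂ F)
+-linear {op₁} {op₂} L₁ L₂ = record
  { ≈ˢ-cong = λ p → +ᶜ-cong (L₁.≈ˢ-cong p) (L₂.≈ˢ-cong p)
  ; +-hom = λ F G → ≈ˢ-trans (+ᶜ-cong (L₁.+-hom F G) (L₂.+-hom F G))
                             (pointwise λ S → medial (op₁ F S) (op₁ G S) (op₂ F S) (op₂ G S))
  ; ·-hom = λ α F → ≈ˢ-trans (+ᶜ-cong (L₁.·-hom α F) (L₂.·-hom α F))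
                             (pointwise λ S → sym (ℚₚ.*-distribˡ-+ α (op₁ F S) (op₂ F S)))
  }
  where
  module L₁ = LinearOp L₁
  module L₂ = LinearOp L₂
  medial : ∀ a b c d → (a ℚ.+ b) ℚ.+ (c ℚ.+ d) ≡ (a ℚ.+ c) ℚ.+ (b ℚ.+ d)
  medial = solve-∀ ℚ-ring

·-linear : ∀ α {op} → LinearOp op → LinearOp (λ F → α ·ᶜ op F)
·-linear α {op} L = record
  { ≈ˢ-cong = λ p → ·ᶜ-cong α (L.≈ˢ-cong p)
  ; +-hom = λ F G → ≈ˢ-trans (·ᶜ-cong α (L.+-hom F G)) (pointwise λ S → ℚₚ.*-distribˡ-+ α (op F S) (op G S))
  ; ·-hom = λ β F → ≈ˢ-trans (·ᶜ-cong α (L.·-hom β F)) (pointwise λ S → *-swap α β (op F S))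
  }
  where module L = LinearOp L

∑-linear : ∀ {N} (ops : Fin N → Op) → (∀ i → LinearOp (ops i)) → LinearOp (λ F → ∑ᶜ (λ i → ops i F))
∑-linear {zero} _ _ = 0-linear
∑-linear {suc N} ops L = +-linear (L Fin.zero) (∑-linear (ops ∘ Fin.suc) (L ∘ Fin.suc))


-- Exterior multiplication and contraction by a generator

infix 9 _⟦_⟧
_⟦_⟧ : Coeffs → SignedMonomial → ℚ
F ⟦ nothing ⟧ = 0ℚ
F ⟦ just (s , T) ⟧ = s ℚ.* F T

pullback : (List Key → SignedMonomial) → Op
pullback f F S = F ⟦ f S ⟧

pullback-linear : ∀ f → PreservesSorted f → LinearOp (pullback f)
pullback-linear f sorted-f = record
  { ≈ˢ-cong = ≈ˢ-cong
  ; +-hom = λ F G → pointwise λ S → +-hom F G (f S)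
  ; ·-hom = λ α F → pointwise λ S → ·-hom α F (f S)
  }
  where
  ≈ˢ-cong : ∀ {F G} → F ≈ˢ G → pullback f F ≈ˢ pullback f G
  ≈ˢ-cong {F} {G} F≈G = mk≈ˢ at-f
    where
    at-f : ∀ S → Sorted S → F ⟦ f S ⟧ ≡ G ⟦ f S ⟧
    at-f S s with f S in eq
    ... | nothing = refl
    ... | just (r , T) = cong (r ℚ.*_) (at F≈G T (sorted-f S s eq))
  +-hom : ∀ F G m → (F +ᶜ G) ⟦ m ⟧ ≡ F ⟦ m ⟧ ℚ.+ G ⟦ m ⟧
  +-hom F G nothing = refl
  +-hom F G (just (r , T)) = ℚₚ.*-distribˡ-+ r (F T) (G T)
  ·-hom : ∀ α F m → (α ·ᶜ F) ⟦ m ⟧ ≡ α ℚ.* F ⟦ m ⟧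
  ·-hom α F nothing = sym (ℚₚ.*-zeroʳ α)
  ·-hom α F (just (r , T)) = *-swap r α (F T)

-- lmul g and contract g are the transposes of left multiplication by e_g and of contraction
-- with the dual functional of e_g; ∂ N sums the contractions over all keys below N.
lmul : Key → Op
lmul g = pullback (remove g)

contract : Key → Op
contract k = pullback (insertK k)

lmul-linear : ∀ g → LinearOp (lmul g)
lmul-linear g = pullback-linear (remove g) (remove-sorted g)

contract-linear : ∀ k → LinearOp (contract k)
contract-linear k = pullback-linear (insertK k) (insertK-sorted k)

⟦⟧->>=ˢ : ∀ F m f → F ⟦ m >>=ˢ f ⟧ ≡ pullback f F ⟦ m ⟧
⟦⟧->>=ˢ F nothing f = refl
⟦⟧->>=ˢ F (just (s , T)) f with f T
... | nothing = sym (ℚₚ.*-zeroʳ s)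
... | just (s′ , T′) = ℚₚ.*-assoc s s′ (F T′)

⟦⟧-negate : ∀ F m → F ⟦ negate m ⟧ ≡ ℚ.- F ⟦ m ⟧
⟦⟧-negate F nothing = refl
⟦⟧-negate F (just (s , T)) = sym (ℚₚ.neg-distribˡ-* s (F T))

lmul-anticomm : ∀ g h F → lmul g (lmul h F) ≈ˢ -ᶜ lmul h (lmul g F)
lmul-anticomm g h F = pointwise λ S → begin
  lmul g (lmul h F) S                       ≡⟨ ⟦⟧->>=ˢ F (remove g S) (remove h) ⟨
  F ⟦ remove g S >>=ˢ remove h ⟧            ≡⟨ cong (F ⟦_⟧) (remove-anticomm g h S) ⟩
  F ⟦ negate (remove h S >>=ˢ remove g) ⟧   ≡⟨ ⟦⟧-negate F (remove h S >>=ˢ remove g) ⟩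
  ℚ.- F ⟦ remove h S >>=ˢ remove g ⟧        ≡⟨ cong ℚ.-_ (⟦⟧->>=ˢ F (remove h S) (remove g)) ⟩
  ℚ.- lmul h (lmul g F) S                   ∎
  where open ≡-Reasoning

contract-lmul-anticomm : ∀ k g F → k ≢ g → contract k (lmul g F) ≈ˢ -ᶜ lmul g (contract k F)
contract-lmul-anticomm k g F k≢g = mk≈ˢ λ S sorted → let open ≡-Reasoning in begin
  contract k (lmul g F) S                     ≡⟨ ⟦⟧->>=ˢ F (insertK k S) (remove g) ⟨
  F ⟦ insertK k S >>=ˢ remove g ⟧             ≡⟨ cong (F ⟦_⟧) (insertK-remove-anticomm k g S k≢g sorted) ⟩
  F ⟦ negate (remove g S >>=ˢ insertK k) ⟧    ≡⟨ ⟦⟧-negate F (remove g S >>=ˢ insertK k) ⟩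
  ℚ.- F ⟦ remove g S >>=ˢ insertK k ⟧         ≡⟨ cong ℚ.-_ (⟦⟧->>=ˢ F (remove g S) (insertK k)) ⟩
  ℚ.- lmul g (contract k F) S                 ∎

contract-lmul-same : ∀ g F → contract g (lmul g F) +ᶜ lmul g (contract g F) ≈ˢ F
contract-lmul-same g F = mk≈ˢ same
  where
  same : ∀ S → Sorted S → contract g (lmul g F) S ℚ.+ lmul g (contract g F) S ≡ F S
  same S sorted
    rewrite sym (⟦⟧->>=ˢ F (insertK g S) (remove g)) | sym (⟦⟧->>=ˢ F (remove g S) (insertK g))
    with remove g S in eq
  ... | just (s , T) rewrite remove⇒insertK-nothing g S eq | remove⇒insertK g S eq =
    trans (ℚₚ.+-identityˡ (s ℚ.* s ℚ.* F S)) (sign²-cancel {s} (F S) (insertK-sign² g T (remove⇒insertK g S eq)))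
  ... | nothing with remove-nothing⇒insertK g S sorted eq
  ...   | (s , S′) , eq′ rewrite eq′ | insertK⇒remove g S eq′ =
    trans (ℚₚ.+-identityʳ (s ℚ.* s ℚ.* F S)) (sign²-cancel {s} (F S) (insertK-sign² g S eq′))

∂ : ℕ → Op
∂ N F = ∑ᶜ {N} λ i → ∑ᶜ {N} λ j → contract (toℕ i , toℕ j) F

∂-linear : ∀ N → LinearOp (∂ N)
∂-linear N = ∑-linear {N} _ λ i → ∑-linear {N} _ λ j → contract-linear (toℕ i , toℕ j)

∂-lmul-anticomm : ∀ {N} (a b : Fin N) F → ∂ N (lmul (toℕ a , toℕ b) F) +ᶜ lmul (toℕ a , toℕ b) (∂ N F) ≈ˢ F
∂-lmul-anticomm {N} a b F = mk≈ˢ λ S sorted → let open ≡-Reasoning in begin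
  ∂ N (lmul g F) S ℚ.+ lmul g (∂ N F) S
    ≡⟨ cong (∂ N (lmul g F) S ℚ.+_) (at lmul-∂ S sorted) ⟩
  sum (λ i → sum (A S i)) ℚ.+ sum (λ i → sum (B S i))
    ≡⟨ ∑∑-distrib-+ (A S) (B S) ⟨
  sum (λ i → sum (λ j → A S i j ℚ.+ B S i j))
    ≡⟨ ∑∑-point (λ i j → A S i j ℚ.+ B S i j) a b (off-diagonal S sorted) ⟩
  A S a b ℚ.+ B S a b
    ≡⟨ at (contract-lmul-same g F) S sorted ⟩
  F S ∎
  where
  g : Key
  g = (toℕ a , toℕ b)
  kᵢⱼ : Fin N → Fin N → Key
  kᵢⱼ i j = (toℕ i , toℕ j)
  A B : List Key → Fin N → Fin N → ℚ
  A S i j = contract (kᵢⱼ i j) (lmul g F) S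
  B S i j = lmul g (contract (kᵢⱼ i j) F) S
  lmul-∂ : lmul g (∂ N F) ≈ˢ ∑ᶜ {N} λ i → ∑ᶜ {N} λ j → lmul g (contract (kᵢⱼ i j) F)
  lmul-∂ = ≈ˢ-trans (LinearOp.∑-hom (lmul-linear g) (λ i → ∑ᶜ {N} λ j → contract (kᵢⱼ i j) F))
                    (∑ᶜ-cong λ i → LinearOp.∑-hom (lmul-linear g) (λ j → contract (kᵢⱼ i j) F))
  kᵢⱼ-injective : ∀ {i j} → kᵢⱼ i j ≡ g → (i , j) ≡ (a , b)
  kᵢⱼ-injective e = cong₂ _,_ (Finₚ.toℕ-injective (cong proj₁ e)) (Finₚ.toℕ-injective (cong proj₂ e))
  off-diagonal : ∀ S → Sorted S → ∀ i j → (i , j) ≢ (a , b) → A S i j ℚ.+ B S i j ≡ 0ℚ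
  off-diagonal S sorted i j ij≢ab =
    trans (cong (ℚ._+ B S i j) (at (contract-lmul-anticomm (kᵢⱼ i j) g F (ij≢ab ∘ kᵢⱼ-injective)) S sorted))
          (ℚₚ.+-inverseˡ (B S i j))

∂-lmul : ∀ {N} (a b : Fin N) F → ∂ N (lmul (toℕ a , toℕ b) F) ≈ˢ F -ᶜ lmul (toℕ a , toℕ b) (∂ N F)
∂-lmul {N} a b F = begin
  ∂ N (lmul g F)                                     ≈⟨ pointwise (λ S → x≡[x+y]-y (∂ N (lmul g F) S) (lmul g (∂ N F) S)) ⟩
  ∂ N (lmul g F) +ᶜ lmul g (∂ N F) -ᶜ lmul g (∂ N F)  ≈⟨ +ᶜ-congʳ (-ᶜ lmul g (∂ N F)) (∂-lmul-anticomm a b F) ⟩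
  F -ᶜ lmul g (∂ N F)                                ∎
  where
  open ≈ˢ-Reasoning
  g : Key
  g = (toℕ a , toℕ b)
  x≡[x+y]-y : ∀ x y → x ≡ x ℚ.+ y ℚ.+ ℚ.- y
  x≡[x+y]-y = solve-∀ ℚ-ring


_≟ᴸ_ : (S T : List Key) → Dec (S ≡ T)
_≟ᴸ_ = Listₚ.≡-dec (Productₚ.≡-dec ℕ._≟_ ℕ._≟_)

coeffₘ : SignedMonomial → Coeffs
coeffₘ nothing S = 0ℚ
coeffₘ (just (s , T)) S with T ≟ᴸ S
... | yes _ = s
... | no _ = 0ℚ

coeffₘ-≡ : ∀ s T → coeffₘ (just (s , T)) T ≡ s
coeffₘ-≡ s T with T ≟ᴸ T
... | yes _ = refl
... | no T≢T = ⊥-elim (T≢T refl)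

coeffW-normal : ∀ {n} (w : Word n) S → coeffW w S ≡ coeffₘ (normal w) S
coeffW-normal w S with normal w
... | nothing = refl
... | just (s , T) with T ≟ᴸ S
...   | yes _ = refl
...   | no _ = refl

normal-∷ : ∀ {n} (g : Gen n) w → normal (g ∷ w) ≡ (normal w >>=ˢ insertK (key g))
normal-∷ g w with normal w
... | nothing = refl
... | just (s , S) with insertK (key g) S
...   | nothing = refl
...   | just _ = refl

coeffₘ-insertK : ∀ g m S → coeffₘ (m >>=ˢ insertK g) S ≡ lmul g (coeffₘ m) S
coeffₘ-insertK g nothing S with remove g S
... | nothing = refl
... | just (s , _) = sym (ℚₚ.*-zeroʳ s)
coeffₘ-insertK g (just (s₀ , T₀)) S with insertK g T₀ in ins-eq
... | nothing with remove g S in rem-eq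
...   | nothing = refl
...   | just (s , T) with T₀ ≟ᴸ T
...     | yes refl with () ← trans (sym ins-eq) (remove⇒insertK g S rem-eq)
...     | no _ = sym (ℚₚ.*-zeroʳ s)
coeffₘ-insertK g (just (s₀ , T₀)) S | just (s′ , S′) with S′ ≟ᴸ S
...   | yes refl rewrite insertK⇒remove g T₀ ins-eq | coeffₘ-≡ s₀ T₀ = ℚₚ.*-comm s₀ s′
...   | no S′≢S with remove g S in rem-eq
...     | nothing = refl
...     | just (s , T) with T₀ ≟ᴸ T
...       | yes refl with refl ← trans (sym ins-eq) (remove⇒insertK g S rem-eq) = ⊥-elim (S′≢S refl)
...       | no _ = sym (ℚₚ.*-zeroʳ s)

coeffW-∷ : ∀ {n} (g : Gen n) w → coeffW (g ∷ w) ≈ˢ lmul (key g) (coeffW w)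
coeffW-∷ g w = ≈ˢ-trans (pointwise insert-into-normal)
                        (LinearOp.≈ˢ-cong (lmul-linear (key g)) (pointwise λ S → sym (coeffW-normal w S)))
  where
  open ≡-Reasoning
  insert-into-normal : ∀ S → coeffW (g ∷ w) S ≡ lmul (key g) (coeffₘ (normal w)) S
  insert-into-normal S = begin
    coeffW (g ∷ w) S                           ≡⟨ coeffW-normal (g ∷ w) S ⟩
    coeffₘ (normal (g ∷ w)) S                  ≡⟨ cong (λ m → coeffₘ m S) (normal-∷ g w) ⟩
    coeffₘ (normal w >>=ˢ insertK (key g)) S   ≡⟨ coeffₘ-insertK (key g) (normal w) S ⟩
    lmul (key g) (coeffₘ (normal w)) S         ∎

infixr 9 _⋆ʷ_ _⋆_

_⋆ʷ_ : ∀ {n} → Word n → Op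
([] ⋆ʷ F) = F
((g ∷ w) ⋆ʷ F) = lmul (key g) (w ⋆ʷ F)

_⋆_ : ∀ {n} → Elt n → Op
([] ⋆ F) = 0ᶜ
(((α , w) ∷ x) ⋆ F) = α ·ᶜ (w ⋆ʷ F) +ᶜ x ⋆ F

⋆ʷ-linear : ∀ {n} (w : Word n) → LinearOp (w ⋆ʷ_)
⋆ʷ-linear [] = id-linear
⋆ʷ-linear (g ∷ w) = ∘-linear (lmul-linear (key g)) (⋆ʷ-linear w)

⋆-linear : ∀ {n} (x : Elt n) → LinearOp (x ⋆_)
⋆-linear [] = 0-linear
⋆-linear ((α , w) ∷ x) = +-linear (·-linear α (⋆ʷ-linear w)) (⋆-linear x)

⋆ʷ-++ : ∀ {n} (w v : Word n) F → (w ++ v) ⋆ʷ F ≡ w ⋆ʷ v ⋆ʷ F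
⋆ʷ-++ [] v F = refl
⋆ʷ-++ (g ∷ w) v F = cong (lmul (key g)) (⋆ʷ-++ w v F)

δ : Coeffs
δ [] = 1ℚ
δ (_ ∷ _) = 0ℚ

coeffW-[] : ∀ {n} → coeffW {n} [] ≈ˢ δ
coeffW-[] = pointwise λ { [] → refl ; (_ ∷ _) → refl }

coeffW-⋆ʷ : ∀ {n} (w : Word n) → coeffW w ≈ˢ w ⋆ʷ δ
coeffW-⋆ʷ {n} [] = coeffW-[] {n}
coeffW-⋆ʷ (g ∷ w) = ≈ˢ-trans (coeffW-∷ g w) (LinearOp.≈ˢ-cong (lmul-linear (key g)) (coeffW-⋆ʷ w))

coeff-⋆ : ∀ {n} (x : Elt n) → coeff x ≈ˢ x ⋆ δ
coeff-⋆ [] = ≈ˢ-refl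
coeff-⋆ ((α , w) ∷ x) = +ᶜ-cong (·ᶜ-cong α (coeffW-⋆ʷ w)) (coeff-⋆ x)

⋆-++ : ∀ {n} (x y : Elt n) F → (x ++ y) ⋆ F ≈ˢ x ⋆ F +ᶜ y ⋆ F
⋆-++ [] y F = pointwise λ S → sym (ℚₚ.+-identityˡ ((y ⋆ F) S))
⋆-++ ((α , w) ∷ x) y F = mk≈ˢ λ S sorted →
  trans (cong (α ℚ.* (w ⋆ʷ F) S ℚ.+_) (at (⋆-++ x y F) S sorted))
        (sym (ℚₚ.+-assoc (α ℚ.* (w ⋆ʷ F) S) ((x ⋆ F) S) ((y ⋆ F) S)))

⋆-· : ∀ {n} α (x : Elt n) F → (α · x) ⋆ F ≈ˢ α ·ᶜ x ⋆ F
⋆-· α [] F = pointwise λ _ → sym (ℚₚ.*-zeroʳ α)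
⋆-· α ((β , w) ∷ x) F = mk≈ˢ λ S sorted →
  trans (cong ((α ℚ.* β) ℚ.* (w ⋆ʷ F) S ℚ.+_) (at (⋆-· α x F) S sorted)) (*-+-regroup α β ((w ⋆ʷ F) S) ((x ⋆ F) S))

⋆-prefix : ∀ {n} α (w : Word n) y F →
           map (λ t → (α ℚ.* proj₁ t , w ++ proj₂ t)) y ⋆ F ≈ˢ α ·ᶜ w ⋆ʷ y ⋆ F
⋆-prefix α w [] F = ≈ˢ-trans (pointwise λ _ → sym (ℚₚ.*-zeroʳ α)) (·ᶜ-cong α (≈ˢ-sym (LinearOp.0-hom (⋆ʷ-linear w))))
⋆-prefix α w ((β , v) ∷ y) F = begin
  (α ℚ.* β) ·ᶜ (w ++ v) ⋆ʷ F +ᶜ map _ y ⋆ F      ≈⟨ +ᶜ-cong (pointwise λ S → cong (λ G → (α ℚ.* β) ℚ.* G S) (⋆ʷ-++ w v F))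
                                                          (⋆-prefix α w y F) ⟩
  (α ℚ.* β) ·ᶜ w ⋆ʷ v ⋆ʷ F +ᶜ α ·ᶜ w ⋆ʷ y ⋆ F    ≈⟨ pointwise (λ S → *-+-regroup α β ((w ⋆ʷ v ⋆ʷ F) S) ((w ⋆ʷ y ⋆ F) S)) ⟩
  α ·ᶜ (β ·ᶜ w ⋆ʷ v ⋆ʷ F +ᶜ w ⋆ʷ y ⋆ F)          ≈⟨ ·ᶜ-cong α (+ᶜ-congʳ (w ⋆ʷ y ⋆ F) (W.·-hom β (v ⋆ʷ F))) ⟨
  α ·ᶜ (w ⋆ʷ (β ·ᶜ v ⋆ʷ F) +ᶜ w ⋆ʷ y ⋆ F)        ≈⟨ ·ᶜ-cong α (W.+-hom (β ·ᶜ v ⋆ʷ F) (y ⋆ F)) ⟨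
  α ·ᶜ w ⋆ʷ (β ·ᶜ v ⋆ʷ F +ᶜ y ⋆ F)              ∎
  where
  open ≈ˢ-Reasoning
  module W = LinearOp (⋆ʷ-linear w)

⋆-⊗ : ∀ {n} (x y : Elt n) F → (x ⊗ y) ⋆ F ≈ˢ x ⋆ y ⋆ F
⋆-⊗ [] y F = ≈ˢ-refl
⋆-⊗ ((α , w) ∷ x) y F =
  ≈ˢ-trans (⋆-++ (map (λ t → (α ℚ.* proj₁ t , w ++ proj₂ t)) y) (x ⊗ y) F)
           (+ᶜ-cong (⋆-prefix α w y F) (⋆-⊗ x y F))

coeff-⊗ : ∀ {n} (x y : Elt n) → coeff (x ⊗ y) ≈ˢ x ⋆ coeff y
coeff-⊗ x y = begin
  coeff (x ⊗ y)    ≈⟨ coeff-⋆ (x ⊗ y) ⟩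
  (x ⊗ y) ⋆ δ      ≈⟨ ⋆-⊗ x y δ ⟩
  x ⋆ y ⋆ δ        ≈⟨ LinearOp.≈ˢ-cong (⋆-linear x) (coeff-⋆ y) ⟨
  x ⋆ coeff y      ∎
  where open ≈ˢ-Reasoning

coeff-⊕ : ∀ {n} (x y : Elt n) → coeff (x ⊕ y) ≈ˢ coeff x +ᶜ coeff y
coeff-⊕ x y = begin
  coeff (x ⊕ y)         ≈⟨ coeff-⋆ (x ⊕ y) ⟩
  (x ⊕ y) ⋆ δ           ≈⟨ ⋆-++ x y δ ⟩
  x ⋆ δ +ᶜ y ⋆ δ        ≈⟨ +ᶜ-cong (coeff-⋆ x) (coeff-⋆ y) ⟨
  coeff x +ᶜ coeff y    ∎
  where open ≈ˢ-Reasoning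

coeff-· : ∀ {n} α (x : Elt n) → coeff (α · x) ≈ˢ α ·ᶜ coeff x
coeff-· α x = begin
  coeff (α · x)    ≈⟨ coeff-⋆ (α · x) ⟩
  (α · x) ⋆ δ      ≈⟨ ⋆-· α x δ ⟩
  α ·ᶜ x ⋆ δ       ≈⟨ ·ᶜ-cong α (coeff-⋆ x) ⟨
  α ·ᶜ coeff x     ∎
  where open ≈ˢ-Reasoning

coeff-combination : ∀ {n} α (x : Elt n) β y → coeff (α · x ⊕ β · y) ≈ˢ α ·ᶜ coeff x +ᶜ β ·ᶜ coeff y
coeff-combination α x β y = ≈ˢ-trans (coeff-⊕ (α · x) (β · y)) (+ᶜ-cong (coeff-· α x) (coeff-· β y))

>>=ˢ-sorted : ∀ m f {s S} → (∀ {s T} → m ≡ just (s , T) → Sorted T) → PreservesSorted f →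
              (m >>=ˢ f) ≡ just (s , S) → Sorted S
>>=ˢ-sorted (just (_ , T)) f sorted-m sorted-f eq with f T in eq′ | eq
... | just _ | refl = sorted-f T (sorted-m refl) eq′

normal-sorted : ∀ {n} (w : Word n) {s S} → normal w ≡ just (s , S) → Sorted S
normal-sorted [] refl = []
normal-sorted (g ∷ w) eq =
  >>=ˢ-sorted (normal w) (insertK (key g)) (normal-sorted w) (insertK-sorted (key g)) (trans (sym (normal-∷ g w)) eq)

coeffW-unsorted : ∀ {n} (w : Word n) S → ¬ Sorted S → coeffW w S ≡ 0ℚ
coeffW-unsorted w S unsorted with normal w in eq
... | nothing = refl
... | just (s , T) with T ≟ᴸ S
...   | yes refl = ⊥-elim (unsorted (normal-sorted w eq))
...   | no _ = refl

coeff-unsorted : ∀ {n} (x : Elt n) S → ¬ Sorted S → coeff x S ≡ 0ℚ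
coeff-unsorted [] S _ = refl
coeff-unsorted ((α , w) ∷ x) S unsorted rewrite coeffW-unsorted w S unsorted | coeff-unsorted x S unsorted =
  trans (ℚₚ.+-identityʳ (α ℚ.* 0ℚ)) (ℚₚ.*-zeroʳ α)

≈ˢ⇒≈Λ : ∀ {n} (x y : Elt n) → coeff x ≈ˢ coeff y → x ≈Λ y
≈ˢ⇒≈Λ x y x≈y S with Linked.linked? _≺?_ S
... | yes sorted = at x≈y S sorted
... | no unsorted = trans (coeff-unsorted x S unsorted) (sym (coeff-unsorted y S unsorted))


-- The derivation

prepend : ∀ {n} → Gen n → Elt n → Elt n
prepend g = map (λ t → (proj₁ t , g ∷ proj₂ t))

deriveʷ : ∀ {n} → Word n → Elt n
deriveʷ [] = []
deriveʷ (g ∷ w) = (1ℚ , w) ∷ (ℚ.- 1ℚ) · prepend g (deriveʷ w)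

derive : ∀ {n} → Elt n → Elt n
derive [] = []
derive ((α , w) ∷ x) = α · deriveʷ w ++ derive x

sign : ∀ {n} → Word n → ℚ
sign [] = 1ℚ
sign (g ∷ w) = ℚ.- sign w

twist : ∀ {n} → Elt n → Elt n
twist = map (λ t → (sign (proj₂ t) ℚ.* proj₁ t , proj₂ t))

⋆-prepend : ∀ {n} (g : Gen n) x F → prepend g x ⋆ F ≈ˢ lmul (key g) (x ⋆ F)
⋆-prepend g [] F = ≈ˢ-sym (LinearOp.0-hom (lmul-linear (key g)))
⋆-prepend g ((α , w) ∷ x) F = begin
  α ·ᶜ lmul (key g) (w ⋆ʷ F) +ᶜ prepend g x ⋆ F         ≈⟨ +ᶜ-congˡ (α ·ᶜ lmul (key g) (w ⋆ʷ F)) (⋆-prepend g x F) ⟩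
  α ·ᶜ lmul (key g) (w ⋆ʷ F) +ᶜ lmul (key g) (x ⋆ F)    ≈⟨ +ᶜ-congʳ (lmul (key g) (x ⋆ F)) (G.·-hom α (w ⋆ʷ F)) ⟨
  lmul (key g) (α ·ᶜ w ⋆ʷ F) +ᶜ lmul (key g) (x ⋆ F)    ≈⟨ G.+-hom (α ·ᶜ w ⋆ʷ F) (x ⋆ F) ⟨
  lmul (key g) (α ·ᶜ w ⋆ʷ F +ᶜ x ⋆ F)                   ∎
  where
  open ≈ˢ-Reasoning
  module G = LinearOp (lmul-linear (key g))

∂-⋆ʷ : ∀ {n} (w : Word n) F → ∂ (suc n) (w ⋆ʷ F) ≈ˢ deriveʷ w ⋆ F +ᶜ sign w ·ᶜ w ⋆ʷ ∂ (suc n) F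
∂-⋆ʷ {n} [] F = pointwise λ S → sym (trans (ℚₚ.+-identityˡ (1ℚ ℚ.* ∂ (suc n) F S)) (ℚₚ.*-identityˡ (∂ (suc n) F S)))
∂-⋆ʷ {n} (g@((i , j) , _) ∷ w) F = begin
  ∂ N (lmul (key g) (w ⋆ʷ F))
    ≈⟨ ∂-lmul i j (w ⋆ʷ F) ⟩
  w ⋆ʷ F -ᶜ lmul (key g) (∂ N (w ⋆ʷ F))
    ≈⟨ +ᶜ-congˡ (w ⋆ʷ F) (-ᶜ-cong (G.≈ˢ-cong (∂-⋆ʷ w F))) ⟩
  w ⋆ʷ F -ᶜ lmul (key g) (deriveʷ w ⋆ F +ᶜ sign w ·ᶜ w ⋆ʷ ∂ N F)
    ≈⟨ +ᶜ-congˡ (w ⋆ʷ F) (-ᶜ-cong (≈ˢ-trans (G.+-hom (deriveʷ w ⋆ F) (sign w ·ᶜ w ⋆ʷ ∂ N F))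
                                              (+ᶜ-congˡ (lmul (key g) (deriveʷ w ⋆ F)) (G.·-hom (sign w) (w ⋆ʷ ∂ N F))))) ⟩
  w ⋆ʷ F -ᶜ (lmul (key g) (deriveʷ w ⋆ F) +ᶜ sign w ·ᶜ lmul (key g) (w ⋆ʷ ∂ N F))
    ≈⟨ pointwise (λ S → rearrange ((w ⋆ʷ F) S) (lmul (key g) (deriveʷ w ⋆ F) S) (sign w) (lmul (key g) (w ⋆ʷ ∂ N F) S)) ⟩
  1ℚ ·ᶜ w ⋆ʷ F +ᶜ (ℚ.- 1ℚ) ·ᶜ lmul (key g) (deriveʷ w ⋆ F) +ᶜ (ℚ.- sign w) ·ᶜ lmul (key g) (w ⋆ʷ ∂ N F)
    ≈⟨ +ᶜ-congʳ ((ℚ.- sign w) ·ᶜ lmul (key g) (w ⋆ʷ ∂ N F))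
               (+ᶜ-congˡ (1ℚ ·ᶜ w ⋆ʷ F) (≈ˢ-trans (⋆-· (ℚ.- 1ℚ) (prepend g (deriveʷ w)) F)
                                                  (·ᶜ-cong (ℚ.- 1ℚ) (⋆-prepend g (deriveʷ w) F)))) ⟨
  deriveʷ (g ∷ w) ⋆ F +ᶜ sign (g ∷ w) ·ᶜ (g ∷ w) ⋆ʷ ∂ N F
    ∎
  where
  N : ℕ
  N = suc n
  open ≈ˢ-Reasoning
  module G = LinearOp (lmul-linear (key g))
  rearrange : ∀ a b s c → a ℚ.- (b ℚ.+ s ℚ.* c) ≡ 1ℚ ℚ.* a ℚ.+ ℚ.- 1ℚ ℚ.* b ℚ.+ ℚ.- s ℚ.* c
  rearrange = solve-∀ ℚ-ring

∂-⋆ : ∀ {n} (x : Elt n) F → ∂ (suc n) (x ⋆ F) ≈ˢ derive x ⋆ F +ᶜ twist x ⋆ ∂ (suc n) F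
∂-⋆ {n} [] F = LinearOp.0-hom (∂-linear (suc n))
∂-⋆ {n} ((α , w) ∷ x) F = begin
  ∂ N (α ·ᶜ w ⋆ʷ F +ᶜ x ⋆ F)
    ≈⟨ ≈ˢ-trans (D.+-hom (α ·ᶜ w ⋆ʷ F) (x ⋆ F)) (+ᶜ-congʳ (∂ N (x ⋆ F)) (D.·-hom α (w ⋆ʷ F))) ⟩
  α ·ᶜ ∂ N (w ⋆ʷ F) +ᶜ ∂ N (x ⋆ F)
    ≈⟨ +ᶜ-cong (·ᶜ-cong α (∂-⋆ʷ w F)) (∂-⋆ x F) ⟩
  α ·ᶜ (deriveʷ w ⋆ F +ᶜ sign w ·ᶜ w ⋆ʷ ∂ N F) +ᶜ (derive x ⋆ F +ᶜ twist x ⋆ ∂ N F)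
    ≈⟨ pointwise (λ S → regroup α ((deriveʷ w ⋆ F) S) (sign w) ((w ⋆ʷ ∂ N F) S) ((derive x ⋆ F) S) ((twist x ⋆ ∂ N F) S)) ⟩
  α ·ᶜ deriveʷ w ⋆ F +ᶜ derive x ⋆ F +ᶜ ((sign w ℚ.* α) ·ᶜ w ⋆ʷ ∂ N F +ᶜ twist x ⋆ ∂ N F)
    ≈⟨ +ᶜ-congʳ (twist ((α , w) ∷ x) ⋆ ∂ N F) (≈ˢ-trans (⋆-++ (α · deriveʷ w) (derive x) F)
                                                         (+ᶜ-congʳ (derive x ⋆ F) (⋆-· α (deriveʷ w) F))) ⟨
  derive ((α , w) ∷ x) ⋆ F +ᶜ twist ((α , w) ∷ x) ⋆ ∂ N F
    ∎
  where
  N : ℕ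
  N = suc n
  open ≈ˢ-Reasoning
  module D = LinearOp (∂-linear N)
  regroup : ∀ α a s c d e → α ℚ.* (a ℚ.+ s ℚ.* c) ℚ.+ (d ℚ.+ e) ≡ α ℚ.* a ℚ.+ d ℚ.+ (s ℚ.* α ℚ.* c ℚ.+ e)
  regroup = solve-∀ ℚ-ring

δ-⟦insertK⟧ : ∀ k S → δ ⟦ insertK k S ⟧ ≡ 0ℚ
δ-⟦insertK⟧ k [] = refl
δ-⟦insertK⟧ k (x ∷ t) with compareKey k x
... | tri< k≺x _ _ rewrite insertK-≺ t k≺x = refl
... | tri≈ _ refl _ rewrite insertK-≡ k t = refl
... | tri> _ _ x≺k rewrite insertK-≻ t x≺k with insertK k t
...   | nothing = refl
...   | just (s , _) = ℚₚ.*-zeroʳ (ℚ.- s)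

∂-δ : ∀ N → ∂ N δ ≈ˢ 0ᶜ
∂-δ N = pointwise λ S →
  ∑-zero {N} _ λ i → ∑-zero {N} _ λ j → δ-⟦insertK⟧ (toℕ i , toℕ j) S

coeff-derive : ∀ {n} (x : Elt n) → coeff (derive x) ≈ˢ ∂ (suc n) (coeff x)
coeff-derive {n} x = begin
  coeff (derive x)                         ≈⟨ coeff-⋆ (derive x) ⟩
  derive x ⋆ δ                             ≈⟨ pointwise (λ S → ℚₚ.+-identityʳ ((derive x ⋆ δ) S)) ⟨
  derive x ⋆ δ +ᶜ 0ᶜ                       ≈⟨ +ᶜ-congˡ (derive x ⋆ δ) (LinearOp.0-hom (⋆-linear (twist x))) ⟨
  derive x ⋆ δ +ᶜ twist x ⋆ 0ᶜ             ≈⟨ +ᶜ-congˡ (derive x ⋆ δ) (LinearOp.≈ˢ-cong (⋆-linear (twist x)) (∂-δ (suc n))) ⟨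
  derive x ⋆ δ +ᶜ twist x ⋆ ∂ (suc n) δ    ≈⟨ ∂-⋆ x δ ⟨
  ∂ (suc n) (x ⋆ δ)                        ≈⟨ LinearOp.≈ˢ-cong (∂-linear (suc n)) (coeff-⋆ x) ⟨
  ∂ (suc n) (coeff x)                      ∎
  where open ≈ˢ-Reasoning

derive-++ : ∀ {n} (x y : Elt n) → derive (x ++ y) ≡ derive x ++ derive y
derive-++ [] y = refl
derive-++ ((α , w) ∷ x) y rewrite derive-++ x y = sym (Listₚ.++-assoc (α · deriveʷ w) (derive x) (derive y))

derive-· : ∀ {n} α (x : Elt n) F → derive (α · x) ⋆ F ≈ˢ α ·ᶜ derive x ⋆ F
derive-· α [] F = pointwise λ _ → sym (ℚₚ.*-zeroʳ α)
derive-· α ((β , w) ∷ x) F = begin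
  ((α ℚ.* β) · deriveʷ w ++ derive (α · x)) ⋆ F
    ≈⟨ ⋆-++ ((α ℚ.* β) · deriveʷ w) (derive (α · x)) F ⟩
  ((α ℚ.* β) · deriveʷ w) ⋆ F +ᶜ derive (α · x) ⋆ F
    ≈⟨ +ᶜ-cong (⋆-· (α ℚ.* β) (deriveʷ w) F) (derive-· α x F) ⟩
  (α ℚ.* β) ·ᶜ deriveʷ w ⋆ F +ᶜ α ·ᶜ derive x ⋆ F
    ≈⟨ pointwise (λ S → *-+-regroup α β ((deriveʷ w ⋆ F) S) ((derive x ⋆ F) S)) ⟩
  α ·ᶜ (β ·ᶜ deriveʷ w ⋆ F +ᶜ derive x ⋆ F)
    ≈⟨ ·ᶜ-cong α (≈ˢ-trans (⋆-++ (β · deriveʷ w) (derive x) F) (+ᶜ-congʳ (derive x ⋆ F) (⋆-· β (deriveʷ w) F))) ⟨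
  α ·ᶜ derive ((β , w) ∷ x) ⋆ F
    ∎
  where open ≈ˢ-Reasoning

derive-⊕ : ∀ {n} (x y : Elt n) F → derive (x ⊕ y) ⋆ F ≈ˢ derive x ⋆ F +ᶜ derive y ⋆ F
derive-⊕ x y F rewrite derive-++ x y = ⋆-++ (derive x) (derive y) F

derive-concatMap : ∀ {n} {A : Set} (f : A → Elt n) xs → derive (concatMap f xs) ≡ concatMap (derive ∘ f) xs
derive-concatMap f [] = refl
derive-concatMap f (x ∷ xs) = trans (derive-++ (f x) (concatMap f xs)) (cong (derive (f x) ++_) (derive-concatMap f xs))

derive-quadratic-word : ∀ {n} α (g h : Gen n) F →
  derive ((α , g ∷ h ∷ []) ∷ []) ⋆ F ≈ˢ α ·ᶜ (lmul (key h) F -ᶜ lmul (key g) F)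
derive-quadratic-word α g h F = pointwise λ S → expand α (lmul (key h) F S) (lmul (key g) F S)
  where
  expand : ∀ α a b → α ℚ.* 1ℚ ℚ.* a ℚ.+ (α ℚ.* (ℚ.- 1ℚ ℚ.* 1ℚ) ℚ.* b ℚ.+ 0ℚ) ≡ α ℚ.* (a ℚ.+ ℚ.- b)
  expand = solve-∀ ℚ-ring


gen : ∀ {n} → Gen n → Elt n
gen g = (1ℚ , g ∷ []) ∷ []

data GenView {n} (i j : Fin (suc n)) : Elt n → Set where
  valid   : (p : i Fin.< j) → GenView i j (gen ((i , j) , p))
  invalid : ¬ i Fin.< j → GenView i j []

e-view : ∀ {n} (i j : Fin (suc n)) → GenView i j (e i j)
e-view i j with i Fin.<? j
... | yes p = valid p
... | no ¬p = invalid ¬p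

Homogeneous : ∀ {n} → ℕ → Elt n → Set
Homogeneous k = All (λ t → length (proj₂ t) ≡ k)

All-concatMap : ∀ {A B : Set} {P : B → Set} (f : A → List B) xs → (∀ a → All P (f a)) → All P (concatMap f xs)
All-concatMap f xs h = Allₚ.concat⁺ (Allₚ.map⁺ (All.universal h xs))

e-homogeneous : ∀ {n} (i j : Fin (suc n)) → Homogeneous 1 (e i j)
e-homogeneous i j with e i j | e-view i j
... | _ | valid _ = refl ∷ []
... | _ | invalid _ = []

e⊗e-homogeneous : ∀ {n} (a b c d : Fin (suc n)) → Homogeneous 2 (e a b ⊗ e c d)
e⊗e-homogeneous a b c d with e a b | e-view a b | e c d | e-view c d
... | _ | valid _ | _ | valid _ = refl ∷ []
... | _ | valid _ | _ | invalid _ = []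
... | _ | invalid _ | _ | _ = []

rel-homogeneous : ∀ {n} (i j k : Fin (suc n)) → Homogeneous 2 (rel i j k)
rel-homogeneous i j k =
  Allₚ.++⁺ (Allₚ.++⁺ (e⊗e-homogeneous i k j k) (Allₚ.map⁺ (e⊗e-homogeneous i j j k))) (e⊗e-homogeneous i j i k)

weight : ∀ {n} → Elt n → ℚ
weight [] = 0ℚ
weight ((α , _) ∷ x) = α ℚ.+ weight x

twist-quadratic : ∀ {n} {x : Elt n} → Homogeneous 2 x → ∀ F → twist x ⋆ F ≈ˢ x ⋆ F
twist-quadratic [] F = ≈ˢ-refl
twist-quadratic {x = (α , g ∷ h ∷ []) ∷ x} (refl ∷ q) F =
  +ᶜ-cong (pointwise λ S → cong (ℚ._* lmul (key g) (lmul (key h) F) S) (ℚₚ.*-identityˡ α)) (twist-quadratic q F)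

derive-linear : ∀ {n} {x : Elt n} → Homogeneous 1 x → ∀ F → derive x ⋆ F ≈ˢ weight x ·ᶜ F
derive-linear [] F = pointwise λ S → sym (ℚₚ.*-zeroˡ (F S))
derive-linear {x = (α , _ ∷ []) ∷ x} (refl ∷ hx) F = begin
  (α ℚ.* 1ℚ) ·ᶜ F +ᶜ derive x ⋆ F    ≈⟨ +ᶜ-congˡ ((α ℚ.* 1ℚ) ·ᶜ F) (derive-linear hx F) ⟩
  (α ℚ.* 1ℚ) ·ᶜ F +ᶜ weight x ·ᶜ F   ≈⟨ pointwise (λ S → collect α (weight x) (F S)) ⟩
  (α ℚ.+ weight x) ·ᶜ F              ∎
  where
  open ≈ˢ-Reasoning
  collect : ∀ a b c → a ℚ.* 1ℚ ℚ.* c ℚ.+ b ℚ.* c ≡ (a ℚ.+ b) ℚ.* c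
  collect = solve-∀ ℚ-ring

twist-linear : ∀ {n} {x : Elt n} → Homogeneous 1 x → ∀ F → twist x ⋆ F ≈ˢ -ᶜ x ⋆ F
twist-linear [] F = ≈ˢ-refl
twist-linear {x = (α , g ∷ []) ∷ x} (refl ∷ hx) F = begin
  (ℚ.- 1ℚ ℚ.* α) ·ᶜ lmul (key g) F +ᶜ twist x ⋆ F    ≈⟨ +ᶜ-congˡ ((ℚ.- 1ℚ ℚ.* α) ·ᶜ lmul (key g) F) (twist-linear hx F) ⟩
  (ℚ.- 1ℚ ℚ.* α) ·ᶜ lmul (key g) F +ᶜ -ᶜ x ⋆ F       ≈⟨ pointwise (λ S → negate-sum α (lmul (key g) F S) ((x ⋆ F) S)) ⟩
  -ᶜ (α ·ᶜ lmul (key g) F +ᶜ x ⋆ F)                  ∎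
  where
  open ≈ˢ-Reasoning
  negate-sum : ∀ a b c → ℚ.- 1ℚ ℚ.* a ℚ.* b ℚ.+ ℚ.- c ≡ ℚ.- (a ℚ.* b ℚ.+ c)
  negate-sum = solve-∀ ℚ-ring

∂-⋆-linear : ∀ {n} {x : Elt n} → Homogeneous 1 x → ∀ F → ∂ (suc n) (x ⋆ F) ≈ˢ weight x ·ᶜ F -ᶜ x ⋆ ∂ (suc n) F
∂-⋆-linear {n} {x} hx F =
  ≈ˢ-trans (∂-⋆ x F) (+ᶜ-cong (derive-linear hx F) (twist-linear hx (∂ (suc n) F)))

lmul-⋆-anticomm : ∀ {n} g {y : Elt n} → Homogeneous 1 y → ∀ F → lmul g (y ⋆ F) ≈ˢ -ᶜ y ⋆ lmul g F
lmul-⋆-anticomm g [] F = LinearOp.0-hom (lmul-linear g)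
lmul-⋆-anticomm g {(β , h ∷ []) ∷ y} (refl ∷ hy) F = begin
  lmul g (β ·ᶜ lmul (key h) F +ᶜ y ⋆ F)
    ≈⟨ ≈ˢ-trans (G.+-hom (β ·ᶜ lmul (key h) F) (y ⋆ F)) (+ᶜ-congʳ (lmul g (y ⋆ F)) (G.·-hom β (lmul (key h) F))) ⟩
  β ·ᶜ lmul g (lmul (key h) F) +ᶜ lmul g (y ⋆ F)
    ≈⟨ +ᶜ-cong (·ᶜ-cong β (lmul-anticomm g (key h) F)) (lmul-⋆-anticomm g hy F) ⟩
  β ·ᶜ -ᶜ lmul (key h) (lmul g F) +ᶜ -ᶜ y ⋆ lmul g F
    ≈⟨ pointwise (λ S → *-neg-+-neg β (lmul (key h) (lmul g F) S) ((y ⋆ lmul g F) S)) ⟩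
  -ᶜ (β ·ᶜ lmul (key h) (lmul g F) +ᶜ y ⋆ lmul g F)
    ∎
  where
  open ≈ˢ-Reasoning
  module G = LinearOp (lmul-linear g)

⋆-anticomm : ∀ {n} {x y : Elt n} → Homogeneous 1 x → Homogeneous 1 y → ∀ F → x ⋆ y ⋆ F ≈ˢ -ᶜ y ⋆ x ⋆ F
⋆-anticomm {y = y} [] hy F = ≈ˢ-sym (-ᶜ-cong (LinearOp.0-hom (⋆-linear y)))
⋆-anticomm {x = (α , g ∷ []) ∷ x} {y} (refl ∷ hx) hy F = begin
  α ·ᶜ lmul (key g) (y ⋆ F) +ᶜ x ⋆ y ⋆ F
    ≈⟨ +ᶜ-cong (·ᶜ-cong α (lmul-⋆-anticomm (key g) hy F)) (⋆-anticomm hx hy F) ⟩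
  α ·ᶜ -ᶜ y ⋆ lmul (key g) F +ᶜ -ᶜ y ⋆ x ⋆ F
    ≈⟨ pointwise (λ S → *-neg-+-neg α ((y ⋆ lmul (key g) F) S) ((y ⋆ x ⋆ F) S)) ⟩
  -ᶜ (α ·ᶜ y ⋆ lmul (key g) F +ᶜ y ⋆ x ⋆ F)
    ≈⟨ -ᶜ-cong (≈ˢ-trans (Y.+-hom (α ·ᶜ lmul (key g) F) (x ⋆ F)) (+ᶜ-congʳ (y ⋆ x ⋆ F) (Y.·-hom α (lmul (key g) F)))) ⟨
  -ᶜ y ⋆ (α ·ᶜ lmul (key g) F +ᶜ x ⋆ F)
    ∎
  where
  open ≈ˢ-Reasoning
  module Y = LinearOp (⋆-linear y)

⋆-square : ∀ {n} {x : Elt n} → Homogeneous 1 x → ∀ F → x ⋆ x ⋆ F ≈ˢ 0ᶜ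
⋆-square hx F = mk≈ˢ λ S sorted → self-negating (at (⋆-anticomm hx hx F) S sorted)
  where
  self-negating : ∀ {q} → q ≡ ℚ.- q → q ≡ 0ℚ
  self-negating {q} q≡-q = trans (half-double q) (trans (cong (λ r → ℚ.½ ℚ.* (q ℚ.+ r)) q≡-q) (half-cancel q))
    where
    half-double : ∀ q → q ≡ ℚ.½ ℚ.* (q ℚ.+ q)
    half-double = solve-∀ ℚ-ring
    half-cancel : ∀ q → ℚ.½ ℚ.* (q ℚ.+ ℚ.- q) ≡ 0ℚ
    half-cancel = solve-∀ ℚ-ring

quadratic-⋆-comm : ∀ {n} {c x : Elt n} → Homogeneous 2 c → Homogeneous 1 x → ∀ F → c ⋆ x ⋆ F ≈ˢ x ⋆ c ⋆ F
quadratic-⋆-comm {x = x} [] hx F = ≈ˢ-sym (LinearOp.0-hom (⋆-linear x))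
quadratic-⋆-comm {c = (γ , g ∷ h ∷ []) ∷ c} {x} (refl ∷ hc) hx F = begin
  γ ·ᶜ lmul (key g) (lmul (key h) (x ⋆ F)) +ᶜ c ⋆ x ⋆ F
    ≈⟨ +ᶜ-cong (·ᶜ-cong γ move-past-g-and-h) (quadratic-⋆-comm hc hx F) ⟩
  γ ·ᶜ x ⋆ lmul (key g) (lmul (key h) F) +ᶜ x ⋆ c ⋆ F
    ≈⟨ ≈ˢ-trans (X.+-hom (γ ·ᶜ lmul (key g) (lmul (key h) F)) (c ⋆ F))
                (+ᶜ-congʳ (x ⋆ c ⋆ F) (X.·-hom γ (lmul (key g) (lmul (key h) F)))) ⟨
  x ⋆ (γ ·ᶜ lmul (key g) (lmul (key h) F) +ᶜ c ⋆ F)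
    ∎
  where
  open ≈ˢ-Reasoning
  module X = LinearOp (⋆-linear x)
  move-past-g-and-h : lmul (key g) (lmul (key h) (x ⋆ F)) ≈ˢ x ⋆ lmul (key g) (lmul (key h) F)
  move-past-g-and-h = begin
    lmul (key g) (lmul (key h) (x ⋆ F))
      ≈⟨ LinearOp.≈ˢ-cong (lmul-linear (key g)) (lmul-⋆-anticomm (key h) hx F) ⟩
    lmul (key g) (-ᶜ x ⋆ lmul (key h) F)
      ≈⟨ LinearOp.-‿hom (lmul-linear (key g)) (x ⋆ lmul (key h) F) ⟩
    -ᶜ lmul (key g) (x ⋆ lmul (key h) F)
      ≈⟨ -ᶜ-cong (lmul-⋆-anticomm (key g) hx (lmul (key h) F)) ⟩
    -ᶜ -ᶜ x ⋆ lmul (key g) (lmul (key h) F)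
      ≈⟨ pointwise (λ S → neg-involutive ((x ⋆ lmul (key g) (lmul (key h) F)) S)) ⟩
    x ⋆ lmul (key g) (lmul (key h) F) ∎


-- Stability of the Orlik–Solomon ideal under ∂

derive-rel : ∀ {n} (i j k : Fin (suc n)) → i Fin.< j → j Fin.< k → ∀ F → derive (rel i j k) ⋆ F ≈ˢ 0ᶜ
derive-rel {n} i j k i<j j<k F with e i j | e-view i j | e j k | e-view j k | e i k | e-view i k
... | _ | invalid i≮j | _ | _ | _ | _ = ⊥-elim (i≮j i<j)
... | _ | valid _ | _ | invalid j≮k | _ | _ = ⊥-elim (j≮k j<k)
... | _ | valid _ | _ | valid _ | _ | invalid i≮k = ⊥-elim (i≮k (Finₚ.<-trans i<j j<k))
... | _ | valid pᵢⱼ | _ | valid pⱼₖ | _ | valid pᵢₖ = begin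
  derive (eᵢₖeⱼₖ ⊕ (ℚ.- 1ℚ) · eᵢⱼeⱼₖ ⊕ eᵢⱼeᵢₖ) ⋆ F
    ≈⟨ ≈ˢ-trans (derive-⊕ (eᵢₖeⱼₖ ⊕ (ℚ.- 1ℚ) · eᵢⱼeⱼₖ) eᵢⱼeᵢₖ F)
                (+ᶜ-congʳ (derive eᵢⱼeᵢₖ ⋆ F) (≈ˢ-trans (derive-⊕ eᵢₖeⱼₖ ((ℚ.- 1ℚ) · eᵢⱼeⱼₖ) F)
                                                        (+ᶜ-congˡ (derive eᵢₖeⱼₖ ⋆ F) (derive-· (ℚ.- 1ℚ) eᵢⱼeⱼₖ F)))) ⟩
  derive eᵢₖeⱼₖ ⋆ F +ᶜ (ℚ.- 1ℚ) ·ᶜ derive eᵢⱼeⱼₖ ⋆ F +ᶜ derive eᵢⱼeᵢₖ ⋆ F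
    ≈⟨ +ᶜ-cong (+ᶜ-cong (derive-quadratic-word 1ℚ gᵢₖ gⱼₖ F) (·ᶜ-cong (ℚ.- 1ℚ) (derive-quadratic-word 1ℚ gᵢⱼ gⱼₖ F)))
               (derive-quadratic-word 1ℚ gᵢⱼ gᵢₖ F) ⟩
  1ℚ ·ᶜ (Eⱼₖ -ᶜ Eᵢₖ) +ᶜ (ℚ.- 1ℚ) ·ᶜ (1ℚ ·ᶜ (Eⱼₖ -ᶜ Eᵢⱼ)) +ᶜ 1ℚ ·ᶜ (Eᵢₖ -ᶜ Eᵢⱼ)
    ≈⟨ pointwise (λ S → cancel (Eᵢⱼ S) (Eⱼₖ S) (Eᵢₖ S)) ⟩
  0ᶜ ∎
  where
  open ≈ˢ-Reasoning
  gᵢⱼ gⱼₖ gᵢₖ : Gen n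
  gᵢⱼ = ((i , j) , pᵢⱼ)
  gⱼₖ = ((j , k) , pⱼₖ)
  gᵢₖ = ((i , k) , pᵢₖ)
  eᵢₖeⱼₖ eᵢⱼeⱼₖ eᵢⱼeᵢₖ : Elt n
  eᵢₖeⱼₖ = gen gᵢₖ ⊗ gen gⱼₖ
  eᵢⱼeⱼₖ = gen gᵢⱼ ⊗ gen gⱼₖ
  eᵢⱼeᵢₖ = gen gᵢⱼ ⊗ gen gᵢₖ
  Eᵢⱼ Eⱼₖ Eᵢₖ : Coeffs
  Eᵢⱼ = lmul (key gᵢⱼ) F
  Eⱼₖ = lmul (key gⱼₖ) F
  Eᵢₖ = lmul (key gᵢₖ) F
  cancel : ∀ a b c → 1ℚ ℚ.* (b ℚ.- c) ℚ.+ ℚ.- 1ℚ ℚ.* (1ℚ ℚ.* (b ℚ.- a)) ℚ.+ 1ℚ ℚ.* (c ℚ.- a) ≡ 0ℚ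
  cancel = solve-∀ ℚ-ring

∂-terms : ∀ {n} → List (RelTerm n) → List (RelTerm n)
∂-terms [] = []
∂-terms (relTerm L i j k i<j j<k R ∷ ts) =
  relTerm (derive L) i j k i<j j<k R ∷ relTerm (twist L) i j k i<j j<k (derive R) ∷ ∂-terms ts

coeff-termOf : ∀ {n} (L : Elt n) i j k i<j j<k R → coeff (termOf (relTerm L i j k i<j j<k R)) ≈ˢ L ⋆ rel i j k ⋆ coeff R
coeff-termOf L i j k _ _ R = ≈ˢ-trans (coeff-⊗ (L ⊗ rel i j k) R) (⋆-⊗ L (rel i j k) (coeff R))

∂-termOf : ∀ {n} (L : Elt n) i j k i<j j<k R →
  ∂ (suc n) (coeff (termOf (relTerm L i j k i<j j<k R))) ≈ˢ
  coeff (termOf (relTerm (derive L) i j k i<j j<k R)) +ᶜ coeff (termOf (relTerm (twist L) i j k i<j j<k (derive R)))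
∂-termOf {n} L i j k i<j j<k R = begin
  ∂ N (coeff (termOf (relTerm L i j k i<j j<k R)))
    ≈⟨ LinearOp.≈ˢ-cong (∂-linear N) (coeff-termOf L i j k i<j j<k R) ⟩
  ∂ N (L ⋆ r ⋆ coeff R)
    ≈⟨ ∂-⋆ L (r ⋆ coeff R) ⟩
  derive L ⋆ r ⋆ coeff R +ᶜ twist L ⋆ ∂ N (r ⋆ coeff R)
    ≈⟨ +ᶜ-congˡ (derive L ⋆ r ⋆ coeff R) (LinearOp.≈ˢ-cong (⋆-linear (twist L)) ∂-rel⋆) ⟩
  derive L ⋆ r ⋆ coeff R +ᶜ twist L ⋆ r ⋆ coeff (derive R)
    ≈⟨ +ᶜ-cong (coeff-termOf (derive L) i j k i<j j<k R) (coeff-termOf (twist L) i j k i<j j<k (derive R)) ⟨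
  coeff (termOf (relTerm (derive L) i j k i<j j<k R)) +ᶜ coeff (termOf (relTerm (twist L) i j k i<j j<k (derive R)))
    ∎
  where
  N : ℕ
  N = suc n
  r : Elt n
  r = rel i j k
  open ≈ˢ-Reasoning
  ∂-rel⋆ : ∂ N (r ⋆ coeff R) ≈ˢ r ⋆ coeff (derive R)
  ∂-rel⋆ = begin
    ∂ N (r ⋆ coeff R)
      ≈⟨ ∂-⋆ r (coeff R) ⟩
    derive r ⋆ coeff R +ᶜ twist r ⋆ ∂ N (coeff R)
      ≈⟨ +ᶜ-cong (derive-rel i j k i<j j<k (coeff R)) (twist-quadratic (rel-homogeneous i j k) _) ⟩
    0ᶜ +ᶜ r ⋆ ∂ N (coeff R)
      ≈⟨ pointwise (λ S → ℚₚ.+-identityˡ ((r ⋆ ∂ N (coeff R)) S)) ⟩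
    r ⋆ ∂ N (coeff R)
      ≈⟨ LinearOp.≈ˢ-cong (⋆-linear r) (coeff-derive R) ⟨
    r ⋆ coeff (derive R) ∎

∂-sumTerms : ∀ {n} (ts : List (RelTerm n)) → ∂ (suc n) (coeff (sumTerms ts)) ≈ˢ coeff (sumTerms (∂-terms ts))
∂-sumTerms {n} [] = LinearOp.0-hom (∂-linear (suc n))
∂-sumTerms {n} (t@(relTerm L i j k i<j j<k R) ∷ ts) = begin
  ∂ N (coeff (termOf t ⊕ sumTerms ts))
    ≈⟨ LinearOp.≈ˢ-cong (∂-linear N) (coeff-⊕ (termOf t) (sumTerms ts)) ⟩
  ∂ N (coeff (termOf t) +ᶜ coeff (sumTerms ts))
    ≈⟨ LinearOp.+-hom (∂-linear N) (coeff (termOf t)) (coeff (sumTerms ts)) ⟩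
  ∂ N (coeff (termOf t)) +ᶜ ∂ N (coeff (sumTerms ts))
    ≈⟨ +ᶜ-cong (∂-termOf L i j k i<j j<k R) (∂-sumTerms ts) ⟩
  coeff (termOf t₁) +ᶜ coeff (termOf t₂) +ᶜ coeff (sumTerms (∂-terms ts))
    ≈⟨ pointwise (λ S → ℚₚ.+-assoc (coeff (termOf t₁) S) (coeff (termOf t₂) S) (coeff (sumTerms (∂-terms ts)) S)) ⟩
  coeff (termOf t₁) +ᶜ (coeff (termOf t₂) +ᶜ coeff (sumTerms (∂-terms ts)))
    ≈⟨ ≈ˢ-trans (coeff-⊕ (termOf t₁) (termOf t₂ ⊕ sumTerms (∂-terms ts)))
                (+ᶜ-congˡ (coeff (termOf t₁)) (coeff-⊕ (termOf t₂) (sumTerms (∂-terms ts)))) ⟨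
  coeff (sumTerms (∂-terms (t ∷ ts)))
    ∎
  where
  N : ℕ
  N = suc n
  t₁ t₂ : RelTerm n
  t₁ = relTerm (derive L) i j k i<j j<k R
  t₂ = relTerm (twist L) i j k i<j j<k (derive R)
  open ≈ˢ-Reasoning

IsZeroOS-∂ : ∀ {n} (x y : Elt n) → IsZeroOS n x → coeff y ≈ˢ ∂ (suc n) (coeff x) → IsZeroOS n y
IsZeroOS-∂ {n} x y (ts , x≈ts) y≈∂x = ∂-terms ts , ≈ˢ⇒≈Λ y (sumTerms (∂-terms ts)) (begin
  coeff y                          ≈⟨ y≈∂x ⟩
  ∂ (suc n) (coeff x)              ≈⟨ LinearOp.≈ˢ-cong (∂-linear (suc n)) (pointwise x≈ts) ⟩
  ∂ (suc n) (coeff (sumTerms ts))  ≈⟨ ∂-sumTerms ts ⟩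
  coeff (sumTerms (∂-terms ts))    ∎)
  where open ≈ˢ-Reasoning


inject₁<fromℕ : ∀ {n} (i : Fin n) → inject₁ i Fin.< fromℕ n
inject₁<fromℕ {n} i = subst (toℕ (inject₁ i) ℕ.<_) (sym (Finₚ.toℕ-fromℕ n)) (Finₚ.inject₁ℕ< i)

⋆-concatMap : ∀ {n N} {A : Set} (f : A → Elt n) (h : Fin N → A) G →
  concatMap f (tabulate h) ⋆ G ≈ˢ ∑ᶜ (λ i → f (h i) ⋆ G)
⋆-concatMap {N = zero} f h G = ≈ˢ-refl
⋆-concatMap {N = suc N} f h G =
  ≈ˢ-trans (⋆-++ (f (h Fin.zero)) (concatMap f (tabulate (h ∘ Fin.suc))) G)
           (+ᶜ-congˡ (f (h Fin.zero) ⋆ G) (⋆-concatMap f (h ∘ Fin.suc) G))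

⋆-pairsSum : ∀ {n} (f : Fin n → Fin n → Elt n) G → pairsSum f ⋆ G ≈ˢ ∑ᶜ {n} λ i → ∑ᶜ {n} λ j → f i j ⋆ G
⋆-pairsSum {n} f G = ≈ˢ-trans (⋆-concatMap (λ i → concatMap (f i) (allFin n)) (λ i → i) G)
                              (∑ᶜ-cong λ i → ⋆-concatMap (f i) (λ j → j) G)

derive-pairsSum : ∀ {n} (f : Fin n → Fin n → Elt n) G →
  derive (pairsSum f) ⋆ G ≈ˢ ∑ᶜ {n} λ i → ∑ᶜ {n} λ j → derive (f i j) ⋆ G
derive-pairsSum {n} f G = begin
  derive (pairsSum f) ⋆ G
    ≡⟨ cong (_⋆ G) (derive-concatMap (λ i → concatMap (f i) (allFin n)) (allFin n)) ⟩
  concatMap (λ i → derive (concatMap (f i) (allFin n))) (allFin n) ⋆ G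
    ≈⟨ ⋆-concatMap (λ i → derive (concatMap (f i) (allFin n))) (λ i → i) G ⟩
  (∑ᶜ {n} λ i → derive (concatMap (f i) (allFin n)) ⋆ G)
    ≈⟨ ∑ᶜ-cong (λ i → ≈ˢ-trans (pointwise λ S → cong (λ y → (y ⋆ G) S) (derive-concatMap (f i) (allFin n)))
                               (⋆-concatMap (derive ∘ f i) (λ j → j) G)) ⟩
  (∑ᶜ {n} λ i → ∑ᶜ {n} λ j → derive (f i j) ⋆ G)
    ∎
  where
  open ≈ˢ-Reasoning

e-⋆ : ∀ {n} (a b : Fin (suc n)) G → e a b ⋆ G ≈ˢ 𝟙 (a Fin.<? b) ·ᶜ lmul (toℕ a , toℕ b) G
e-⋆ a b G with a Fin.<? b
... | yes _ = pointwise λ S → ℚₚ.+-identityʳ (1ℚ ℚ.* lmul (toℕ a , toℕ b) G S)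
... | no _ = pointwise λ S → sym (ℚₚ.*-zeroˡ (lmul (toℕ a , toℕ b) G S))

derive-c-term : ∀ {n} (a b c : Fin (suc n)) → a Fin.< c → b Fin.< c → ∀ G →
  derive (e a b ⊗ e a c ⊕ e a b ⊗ e b c) ⋆ G ≈ˢ
  𝟙 (a Fin.<? b) ·ᶜ (lmul (toℕ a , toℕ c) G -ᶜ lmul (toℕ a , toℕ b) G +ᶜ (lmul (toℕ b , toℕ c) G -ᶜ lmul (toℕ a , toℕ b) G))
derive-c-term {n} a b c a<c b<c G with a Fin.<? b
... | no _ = pointwise λ S → sym (ℚₚ.*-zeroˡ (lmul (toℕ a , toℕ c) G S ℚ.- lmul (toℕ a , toℕ b) G S
                                              ℚ.+ (lmul (toℕ b , toℕ c) G S ℚ.- lmul (toℕ a , toℕ b) G S)))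
... | yes a<b with e a c | e-view a c | e b c | e-view b c
...   | _ | invalid a≮c | _ | _ = ⊥-elim (a≮c a<c)
...   | _ | valid _ | _ | invalid b≮c = ⊥-elim (b≮c b<c)
...   | _ | valid pₐ꜀ | _ | valid pᵦ꜀ = begin
  derive (gen gₐᵦ ⊗ gen gₐ꜀ ⊕ gen gₐᵦ ⊗ gen gᵦ꜀) ⋆ G
    ≈⟨ derive-⊕ (gen gₐᵦ ⊗ gen gₐ꜀) (gen gₐᵦ ⊗ gen gᵦ꜀) G ⟩
  derive (gen gₐᵦ ⊗ gen gₐ꜀) ⋆ G +ᶜ derive (gen gₐᵦ ⊗ gen gᵦ꜀) ⋆ G
    ≈⟨ +ᶜ-cong (derive-quadratic-word 1ℚ gₐᵦ gₐ꜀ G) (derive-quadratic-word 1ℚ gₐᵦ gᵦ꜀ G) ⟩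
  1ℚ ·ᶜ (Eₐ꜀ -ᶜ Eₐᵦ) +ᶜ 1ℚ ·ᶜ (Eᵦ꜀ -ᶜ Eₐᵦ)
    ≈⟨ pointwise (λ S → unit (Eₐ꜀ S) (Eₐᵦ S) (Eᵦ꜀ S)) ⟩
  1ℚ ·ᶜ (Eₐ꜀ -ᶜ Eₐᵦ +ᶜ (Eᵦ꜀ -ᶜ Eₐᵦ))
    ∎
  where
  open ≈ˢ-Reasoning
  gₐᵦ gₐ꜀ gᵦ꜀ : Gen n
  gₐᵦ = ((a , b) , a<b)
  gₐ꜀ = ((a , c) , pₐ꜀)
  gᵦ꜀ = ((b , c) , pᵦ꜀)
  Eₐᵦ Eₐ꜀ Eᵦ꜀ : Coeffs
  Eₐᵦ = lmul (toℕ a , toℕ b) G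
  Eₐ꜀ = lmul (toℕ a , toℕ c) G
  Eᵦ꜀ = lmul (toℕ b , toℕ c) G
  unit : ∀ x y z → 1ℚ ℚ.* (x ℚ.- y) ℚ.+ 1ℚ ℚ.* (z ℚ.- y) ≡ 1ℚ ℚ.* (x ℚ.- y ℚ.+ (z ℚ.- y))
  unit = solve-∀ ℚ-ring

module Expansion (n : ℕ) (G : Coeffs) where

  I : Fin n → Fin n → ℚ
  I i j = 𝟙 (inject₁ i Fin.<? inject₁ j)

  Eᵢ : Fin n → Coeffs
  Eᵢ i = lmul (toℕ (inject₁ i) , toℕ (fromℕ n)) G

  Eᵢⱼ : Fin n → Fin n → Coeffs
  Eᵢⱼ i j = lmul (toℕ (inject₁ i) , toℕ (inject₁ j)) G

  I-total : ∀ i j → I i j ℚ.+ I j i ℚ.+ 𝟙 (j Finₚ.≟ i) ≡ 1ℚ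
  I-total i j with Finₚ.<-cmp (inject₁ i) (inject₁ j)
  ... | tri< i<j i≢j j≮i
    rewrite 𝟙-yes i<j (inject₁ i Fin.<? inject₁ j) | 𝟙-no j≮i (inject₁ j Fin.<? inject₁ i)
          | 𝟙-no (i≢j ∘ cong inject₁ ∘ sym) (j Finₚ.≟ i) = refl
  ... | tri≈ i≮j i≡j j≮i
    rewrite 𝟙-no i≮j (inject₁ i Fin.<? inject₁ j) | 𝟙-no j≮i (inject₁ j Fin.<? inject₁ i)
          | 𝟙-yes (sym (Finₚ.inject₁-injective i≡j)) (j Finₚ.≟ i) = refl
  ... | tri> i≮j i≢j j<i
    rewrite 𝟙-no i≮j (inject₁ i Fin.<? inject₁ j) | 𝟙-yes j<i (inject₁ j Fin.<? inject₁ i)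
          | 𝟙-no (i≢j ∘ cong inject₁ ∘ sym) (j Finₚ.≟ i) = refl

  a⋆ : aE n ⋆ G ≈ˢ ∑ᶜ {n} λ i → ∑ᶜ {n} λ j → I i j ·ᶜ Eᵢⱼ i j
  a⋆ = ≈ˢ-trans (⋆-pairsSum {n} (λ i j → e (inject₁ i) (inject₁ j)) G)
                (∑ᶜ-cong {n} λ i → ∑ᶜ-cong {n} λ j → e-⋆ (inject₁ i) (inject₁ j) G)

  m⋆ : mE n ⋆ G ≈ˢ ∑ᶜ Eᵢ
  m⋆ = ≈ˢ-trans (⋆-concatMap (λ i → e (inject₁ i) (fromℕ n)) (λ i → i) G)
                (∑ᶜ-cong {n} λ i → ≈ˢ-trans (e-⋆ (inject₁ i) (fromℕ n) G) (pointwise λ S →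
                  trans (cong (ℚ._* Eᵢ i S) (𝟙-yes (inject₁<fromℕ i) (inject₁ i Fin.<? fromℕ n))) (ℚₚ.*-identityˡ (Eᵢ i S))))

  derive-c⋆ : derive (cE n) ⋆ G ≈ˢ ∑ᶜ {n} λ i → ∑ᶜ {n} λ j → I i j ·ᶜ (Eᵢ i -ᶜ Eᵢⱼ i j +ᶜ (Eᵢ j -ᶜ Eᵢⱼ i j))
  derive-c⋆ = ≈ˢ-trans (derive-pairsSum {n} cᵢⱼ G) (∑ᶜ-cong {n} λ i → ∑ᶜ-cong {n} λ j →
    derive-c-term (inject₁ i) (inject₁ j) (fromℕ n) (inject₁<fromℕ i) (inject₁<fromℕ j) G)
    where
    cᵢⱼ : Fin n → Fin n → Elt n
    cᵢⱼ i j = e (inject₁ i) (inject₁ j) ⊗ e (inject₁ i) (fromℕ n) ⊕ e (inject₁ i) (inject₁ j) ⊗ e (inject₁ j) (fromℕ n)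

  derive-c : derive (cE n) ⋆ G ≈ˢ κ n ·ᶜ mE n ⋆ G -ᶜ two ·ᶜ aE n ⋆ G
  derive-c = begin
    derive (cE n) ⋆ G
      ≈⟨ derive-c⋆ ⟩
    (∑ᶜ {n} λ i → ∑ᶜ {n} λ j → I i j ·ᶜ (Eᵢ i -ᶜ Eᵢⱼ i j +ᶜ (Eᵢ j -ᶜ Eᵢⱼ i j)))
      ≈⟨ pointwise (λ S → ∑-ordered-pairs-edges I (λ i → Eᵢ i S) (λ i j → Eᵢⱼ i j S) I-total) ⟩
    κ n ·ᶜ ∑ᶜ Eᵢ -ᶜ two ·ᶜ (∑ᶜ {n} λ i → ∑ᶜ {n} λ j → I i j ·ᶜ Eᵢⱼ i j)
      ≈⟨ -ᶜ-cong₂ (·ᶜ-cong (κ n) m⋆) (·ᶜ-cong two a⋆) ⟨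
    κ n ·ᶜ mE n ⋆ G -ᶜ two ·ᶜ aE n ⋆ G
      ∎
    where open ≈ˢ-Reasoning

a-linear : ∀ n → Homogeneous 1 (aE n)
a-linear n = All-concatMap _ (allFin n) λ i → All-concatMap _ (allFin n) λ j → e-homogeneous (inject₁ i) (inject₁ j)

m-linear : ∀ n → Homogeneous 1 (mE n)
m-linear n = All-concatMap _ (allFin n) λ i → e-homogeneous (inject₁ i) (fromℕ n)

c-quadratic : ∀ n → Homogeneous 2 (cE n)
c-quadratic n = All-concatMap _ (allFin n) λ i → All-concatMap _ (allFin n) λ j →
  Allₚ.++⁺ (e⊗e-homogeneous (inject₁ i) (inject₁ j) (inject₁ i) (fromℕ n))
           (e⊗e-homogeneous (inject₁ i) (inject₁ j) (inject₁ j) (fromℕ n))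

NonNegative : ∀ {n} → Elt n → Set
NonNegative = All (λ t → 0ℚ ℚ.≤ proj₁ t)

e-nonNegative : ∀ {n} (i j : Fin (suc n)) → NonNegative (e i j)
e-nonNegative i j with e i j | e-view i j
... | _ | valid _ = ℚₚ.<⇒≤ (ℚₚ.positive⁻¹ 1ℚ) ∷ []
... | _ | invalid _ = []

weight-nonNegative : ∀ {n} {x : Elt n} → NonNegative x → 0ℚ ℚ.≤ weight x
weight-nonNegative [] = ℚₚ.≤-refl
weight-nonNegative (0≤α ∷ nx) = ℚₚ.+-mono-≤ 0≤α (weight-nonNegative nx)

a-nonNegative : ∀ n → 0ℚ ℚ.≤ weight (aE n)
a-nonNegative n = weight-nonNegative (All-concatMap _ (allFin n) λ i → All-concatMap _ (allFin n) λ j →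
  e-nonNegative (inject₁ i) (inject₁ j))

m-positive : ∀ n → 0ℚ ℚ.< weight (mE (suc n))
m-positive n with e (inject₁ Fin.zero) (fromℕ (suc n)) | e-view (inject₁ (Fin.zero {n})) (fromℕ (suc n))
... | _ | invalid 0≮n = ⊥-elim (0≮n (inject₁<fromℕ Fin.zero))
... | _ | valid _ = ℚₚ.+-mono-<-≤ (ℚₚ.positive⁻¹ 1ℚ) (weight-nonNegative rest-nonNegative)
  where
  f : Fin (suc n) → Elt (suc n)
  f i = e (inject₁ i) (fromℕ (suc n))
  rest-nonNegative : NonNegative (concatMap f (tabulate Fin.suc))
  rest-nonNegative = All-concatMap f (tabulate Fin.suc) λ i → e-nonNegative (inject₁ i) (fromℕ (suc n))

module Powers (n : ℕ) where

  a m c : Elt n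
  a = aE n
  m = mE n
  c = cE n

  N : ℕ
  N = suc n

  C : ℕ → Coeffs
  C d = coeff (c ^ d)

  ha : Homogeneous 1 a
  ha = a-linear n

  hm : Homogeneous 1 m
  hm = m-linear n

  hc : Homogeneous 2 c
  hc = c-quadratic n

  module A = LinearOp (⋆-linear a)
  module M = LinearOp (⋆-linear m)
  module Cₒ = LinearOp (⋆-linear c)
  module AM = LinearOp (∘-linear (⋆-linear a) (⋆-linear m))
  module ∂ₒ = LinearOp (∂-linear N)

  open ≈ˢ-Reasoning

  m⋆∂c : ∀ G → m ⋆ derive c ⋆ G ≈ˢ two ·ᶜ a ⋆ m ⋆ G
  m⋆∂c G = begin
    m ⋆ derive c ⋆ G
      ≈⟨ M.≈ˢ-cong (Expansion.derive-c n G) ⟩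
    m ⋆ (κ n ·ᶜ m ⋆ G -ᶜ two ·ᶜ a ⋆ G)
      ≈⟨ M.-‿hom₂ (κ n ·ᶜ m ⋆ G) (two ·ᶜ a ⋆ G) ⟩
    m ⋆ (κ n ·ᶜ m ⋆ G) -ᶜ m ⋆ (two ·ᶜ a ⋆ G)
      ≈⟨ -ᶜ-cong₂ (M.·-hom (κ n) (m ⋆ G)) (M.·-hom two (a ⋆ G)) ⟩
    κ n ·ᶜ m ⋆ m ⋆ G -ᶜ two ·ᶜ m ⋆ a ⋆ G
      ≈⟨ -ᶜ-cong₂ (·ᶜ-cong (κ n) (⋆-square hm G)) (·ᶜ-cong two (⋆-anticomm hm ha G)) ⟩
    κ n ·ᶜ 0ᶜ -ᶜ two ·ᶜ -ᶜ a ⋆ m ⋆ G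
      ≈⟨ pointwise (λ S → simplify (κ n) two ((a ⋆ m ⋆ G) S)) ⟩
    two ·ᶜ a ⋆ m ⋆ G ∎
    where
    simplify : ∀ k t x → k ℚ.* 0ℚ ℚ.- t ℚ.* ℚ.- x ≡ t ℚ.* x
    simplify = solve-∀ ℚ-ring

  a⋆∂c : ∀ G → a ⋆ derive c ⋆ G ≈ˢ κ n ·ᶜ a ⋆ m ⋆ G
  a⋆∂c G = begin
    a ⋆ derive c ⋆ G
      ≈⟨ A.≈ˢ-cong (Expansion.derive-c n G) ⟩
    a ⋆ (κ n ·ᶜ m ⋆ G -ᶜ two ·ᶜ a ⋆ G)
      ≈⟨ A.-‿hom₂ (κ n ·ᶜ m ⋆ G) (two ·ᶜ a ⋆ G) ⟩
    a ⋆ (κ n ·ᶜ m ⋆ G) -ᶜ a ⋆ (two ·ᶜ a ⋆ G)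
      ≈⟨ -ᶜ-cong₂ (A.·-hom (κ n) (m ⋆ G)) (A.·-hom two (a ⋆ G)) ⟩
    κ n ·ᶜ a ⋆ m ⋆ G -ᶜ two ·ᶜ a ⋆ a ⋆ G
      ≈⟨ -ᶜ-cong₂ (≈ˢ-refl {κ n ·ᶜ a ⋆ m ⋆ G}) (·ᶜ-cong two (⋆-square ha G)) ⟩
    κ n ·ᶜ a ⋆ m ⋆ G -ᶜ two ·ᶜ 0ᶜ
      ≈⟨ pointwise (λ S → simplify (κ n) two ((a ⋆ m ⋆ G) S)) ⟩
    κ n ·ᶜ a ⋆ m ⋆ G ∎
    where
    simplify : ∀ k t x → k ℚ.* x ℚ.- t ℚ.* 0ℚ ≡ k ℚ.* x
    simplify = solve-∀ ℚ-ring

  c-central : ∀ G → a ⋆ m ⋆ c ⋆ G ≈ˢ c ⋆ a ⋆ m ⋆ G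
  c-central G = ≈ˢ-trans (A.≈ˢ-cong (≈ˢ-sym (quadratic-⋆-comm hc hm G))) (≈ˢ-sym (quadratic-⋆-comm hc ha (m ⋆ G)))

  ∂C-zero : ∂ N (C 0) ≈ˢ 0ᶜ
  ∂C-zero = ≈ˢ-sym (coeff-derive {n} one)

  ∂C-suc : ∀ d → ∂ N (C (suc d)) ≈ˢ derive c ⋆ C d +ᶜ c ⋆ ∂ N (C d)
  ∂C-suc d = begin
    ∂ N (C (suc d))                                 ≈⟨ ∂ₒ.≈ˢ-cong (coeff-⊗ c (c ^ d)) ⟩
    ∂ N (c ⋆ C d)                                   ≈⟨ ∂-⋆ c (C d) ⟩
    derive c ⋆ C d +ᶜ twist c ⋆ ∂ N (C d)           ≈⟨ +ᶜ-congˡ (derive c ⋆ C d) (twist-quadratic hc (∂ N (C d))) ⟩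
    derive c ⋆ C d +ᶜ c ⋆ ∂ N (C d)                 ∎

  am∂C : ∀ d → a ⋆ m ⋆ ∂ N (C d) ≈ˢ 0ᶜ
  am∂C zero = ≈ˢ-trans (AM.≈ˢ-cong ∂C-zero) AM.0-hom
  am∂C (suc d) = begin
    a ⋆ m ⋆ ∂ N (C (suc d))
      ≈⟨ AM.≈ˢ-cong (∂C-suc d) ⟩
    a ⋆ m ⋆ (derive c ⋆ C d +ᶜ c ⋆ ∂ N (C d))
      ≈⟨ AM.+-hom (derive c ⋆ C d) (c ⋆ ∂ N (C d)) ⟩
    a ⋆ m ⋆ derive c ⋆ C d +ᶜ a ⋆ m ⋆ c ⋆ ∂ N (C d)
      ≈⟨ +ᶜ-cong (A.≈ˢ-cong (m⋆∂c (C d))) (c-central (∂ N (C d))) ⟩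
    a ⋆ (two ·ᶜ a ⋆ m ⋆ C d) +ᶜ c ⋆ a ⋆ m ⋆ ∂ N (C d)
      ≈⟨ +ᶜ-cong (≈ˢ-trans (A.·-hom two (a ⋆ m ⋆ C d)) (·ᶜ-cong two (⋆-square ha (m ⋆ C d))))
                 (≈ˢ-trans (Cₒ.≈ˢ-cong (am∂C d)) Cₒ.0-hom) ⟩
    two ·ᶜ 0ᶜ +ᶜ 0ᶜ
      ≈⟨ pointwise (λ _ → ℚₚ.+-identityʳ (two ℚ.* 0ℚ)) ⟩
    two ·ᶜ 0ᶜ
      ≈⟨ pointwise (λ _ → ℚₚ.*-zeroʳ two) ⟩
    0ᶜ ∎

  γ : ℕ → ℚ
  γ zero = 0ℚ
  γ (suc d) = κ n ℚ.+ two ℚ.+ γ d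

  γ-shift : ∀ d → γ d ·ᶜ c ⋆ a ⋆ m ⋆ C (d ∸ 1) ≈ˢ γ d ·ᶜ a ⋆ m ⋆ C d
  γ-shift zero = pointwise λ S → trans (ℚₚ.*-zeroˡ ((c ⋆ a ⋆ m ⋆ C 0) S)) (sym (ℚₚ.*-zeroˡ ((a ⋆ m ⋆ C 0) S)))
  γ-shift (suc d) = ·ᶜ-cong (γ (suc d)) (≈ˢ-trans (≈ˢ-sym (c-central (C d))) (AM.≈ˢ-cong (≈ˢ-sym (coeff-⊗ c (c ^ d)))))

  a+m⋆∂C : ∀ d → a ⋆ ∂ N (C d) +ᶜ m ⋆ ∂ N (C d) ≈ˢ γ d ·ᶜ a ⋆ m ⋆ C (d ∸ 1)
  a+m⋆∂C zero = ≈ˢ-trans (+ᶜ-cong (≈ˢ-trans (A.≈ˢ-cong ∂C-zero) A.0-hom) (≈ˢ-trans (M.≈ˢ-cong ∂C-zero) M.0-hom))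
                         (pointwise λ S → sym (ℚₚ.*-zeroˡ ((a ⋆ m ⋆ C 0) S)))
  a+m⋆∂C (suc d) = begin
    a ⋆ ∂ N (C (suc d)) +ᶜ m ⋆ ∂ N (C (suc d))
      ≈⟨ +ᶜ-cong (≈ˢ-trans (A.≈ˢ-cong (∂C-suc d)) (A.+-hom (derive c ⋆ C d) (c ⋆ ∂ N (C d))))
                 (≈ˢ-trans (M.≈ˢ-cong (∂C-suc d)) (M.+-hom (derive c ⋆ C d) (c ⋆ ∂ N (C d)))) ⟩
    (a ⋆ derive c ⋆ C d +ᶜ a ⋆ c ⋆ ∂ N (C d)) +ᶜ (m ⋆ derive c ⋆ C d +ᶜ m ⋆ c ⋆ ∂ N (C d))
      ≈⟨ +ᶜ-cong (+ᶜ-cong (a⋆∂c (C d)) (≈ˢ-sym (quadratic-⋆-comm hc ha (∂ N (C d)))))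
                 (+ᶜ-cong (m⋆∂c (C d)) (≈ˢ-sym (quadratic-⋆-comm hc hm (∂ N (C d))))) ⟩
    (κ n ·ᶜ X d +ᶜ c ⋆ a ⋆ ∂ N (C d)) +ᶜ (two ·ᶜ X d +ᶜ c ⋆ m ⋆ ∂ N (C d))
      ≈⟨ pointwise (λ S → regroup (κ n) two (X d S) ((c ⋆ a ⋆ ∂ N (C d)) S) ((c ⋆ m ⋆ ∂ N (C d)) S)) ⟩
    (κ n ℚ.+ two) ·ᶜ X d +ᶜ (c ⋆ a ⋆ ∂ N (C d) +ᶜ c ⋆ m ⋆ ∂ N (C d))
      ≈⟨ +ᶜ-congˡ ((κ n ℚ.+ two) ·ᶜ X d) (Cₒ.+-hom (a ⋆ ∂ N (C d)) (m ⋆ ∂ N (C d))) ⟨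
    (κ n ℚ.+ two) ·ᶜ X d +ᶜ c ⋆ (a ⋆ ∂ N (C d) +ᶜ m ⋆ ∂ N (C d))
      ≈⟨ +ᶜ-congˡ ((κ n ℚ.+ two) ·ᶜ X d) (≈ˢ-trans (Cₒ.≈ˢ-cong (a+m⋆∂C d)) (Cₒ.·-hom (γ d) (a ⋆ m ⋆ C (d ∸ 1)))) ⟩
    (κ n ℚ.+ two) ·ᶜ X d +ᶜ γ d ·ᶜ c ⋆ a ⋆ m ⋆ C (d ∸ 1)
      ≈⟨ +ᶜ-congˡ ((κ n ℚ.+ two) ·ᶜ X d) (γ-shift d) ⟩
    (κ n ℚ.+ two) ·ᶜ X d +ᶜ γ d ·ᶜ X d
      ≈⟨ pointwise (λ S → sym (ℚₚ.*-distribʳ-+ (X d S) (κ n ℚ.+ two) (γ d))) ⟩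
    γ (suc d) ·ᶜ X d ∎
    where
    X : ℕ → Coeffs
    X d = a ⋆ m ⋆ C d
    regroup : ∀ k t x y z → k ℚ.* x ℚ.+ y ℚ.+ (t ℚ.* x ℚ.+ z) ≡ (k ℚ.+ t) ℚ.* x ℚ.+ (y ℚ.+ z)
    regroup = solve-∀ ℚ-ring

  ∂-amcᵈ : ∀ d → ∂ N (coeff (a ⊗ m ⊗ c ^ d)) ≈ˢ coeff ((ℚ.- weight m) · (a ⊗ c ^ d) ⊕ weight a · (m ⊗ c ^ d))
  ∂-amcᵈ d = begin
    ∂ N (coeff (a ⊗ m ⊗ c ^ d))
      ≈⟨ ∂ₒ.≈ˢ-cong (≈ˢ-trans (coeff-⊗ (a ⊗ m) (c ^ d)) (⋆-⊗ a m (C d))) ⟩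
    ∂ N (a ⋆ m ⋆ C d)
      ≈⟨ ∂-⋆-linear ha (m ⋆ C d) ⟩
    weight a ·ᶜ m ⋆ C d -ᶜ a ⋆ ∂ N (m ⋆ C d)
      ≈⟨ -ᶜ-cong₂ (≈ˢ-refl {weight a ·ᶜ m ⋆ C d}) (A.≈ˢ-cong (∂-⋆-linear hm (C d))) ⟩
    weight a ·ᶜ m ⋆ C d -ᶜ a ⋆ (weight m ·ᶜ C d -ᶜ m ⋆ ∂ N (C d))
      ≈⟨ -ᶜ-cong₂ (≈ˢ-refl {weight a ·ᶜ m ⋆ C d}) (≈ˢ-trans (A.-‿hom₂ (weight m ·ᶜ C d) (m ⋆ ∂ N (C d)))
                                                             (-ᶜ-cong₂ (A.·-hom (weight m) (C d)) (am∂C d))) ⟩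
    weight a ·ᶜ m ⋆ C d -ᶜ (weight m ·ᶜ a ⋆ C d -ᶜ 0ᶜ)
      ≈⟨ pointwise (λ S → rearrange (weight a) (weight m) ((m ⋆ C d) S) ((a ⋆ C d) S)) ⟩
    (ℚ.- weight m) ·ᶜ a ⋆ C d +ᶜ weight a ·ᶜ m ⋆ C d
      ≈⟨ ≈ˢ-trans (coeff-combination (ℚ.- weight m) (a ⊗ c ^ d) (weight a) (m ⊗ c ^ d))
                  (+ᶜ-cong (·ᶜ-cong (ℚ.- weight m) (coeff-⊗ a (c ^ d))) (·ᶜ-cong (weight a) (coeff-⊗ m (c ^ d)))) ⟨
    coeff ((ℚ.- weight m) · (a ⊗ c ^ d) ⊕ weight a · (m ⊗ c ^ d)) ∎
    where
    rearrange : ∀ wa wm x y → wa ℚ.* x ℚ.- (wm ℚ.* y ℚ.- 0ℚ) ≡ ℚ.- wm ℚ.* y ℚ.+ wa ℚ.* x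
    rearrange = solve-∀ ℚ-ring

  ∂-acᵈ+mcᵈ : ∀ d → ∂ N (coeff (a ⊗ c ^ d ⊕ m ⊗ c ^ d)) ≈ˢ
              coeff ((ℚ.- γ d) · (a ⊗ m ⊗ c ^ (d ∸ 1)) ⊕ (weight a ℚ.+ weight m) · c ^ d)
  ∂-acᵈ+mcᵈ d = begin
    ∂ N (coeff (a ⊗ c ^ d ⊕ m ⊗ c ^ d))
      ≈⟨ ∂ₒ.≈ˢ-cong (≈ˢ-trans (coeff-⊕ (a ⊗ c ^ d) (m ⊗ c ^ d)) (+ᶜ-cong (coeff-⊗ a (c ^ d)) (coeff-⊗ m (c ^ d)))) ⟩
    ∂ N (a ⋆ C d +ᶜ m ⋆ C d)
      ≈⟨ ∂ₒ.+-hom (a ⋆ C d) (m ⋆ C d) ⟩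
    ∂ N (a ⋆ C d) +ᶜ ∂ N (m ⋆ C d)
      ≈⟨ +ᶜ-cong (∂-⋆-linear ha (C d)) (∂-⋆-linear hm (C d)) ⟩
    (weight a ·ᶜ C d -ᶜ a ⋆ ∂ N (C d)) +ᶜ (weight m ·ᶜ C d -ᶜ m ⋆ ∂ N (C d))
      ≈⟨ pointwise (λ S → regroup (weight a) (weight m) (C d S) ((a ⋆ ∂ N (C d)) S) ((m ⋆ ∂ N (C d)) S)) ⟩
    (weight a ℚ.+ weight m) ·ᶜ C d -ᶜ (a ⋆ ∂ N (C d) +ᶜ m ⋆ ∂ N (C d))
      ≈⟨ -ᶜ-cong₂ (≈ˢ-refl {(weight a ℚ.+ weight m) ·ᶜ C d}) (a+m⋆∂C d) ⟩
    (weight a ℚ.+ weight m) ·ᶜ C d -ᶜ γ d ·ᶜ a ⋆ m ⋆ C (d ∸ 1)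
      ≈⟨ pointwise (λ S → swap (weight a ℚ.+ weight m) (C d S) (γ d) ((a ⋆ m ⋆ C (d ∸ 1)) S)) ⟩
    (ℚ.- γ d) ·ᶜ a ⋆ m ⋆ C (d ∸ 1) +ᶜ (weight a ℚ.+ weight m) ·ᶜ C d
      ≈⟨ ≈ˢ-trans (coeff-combination (ℚ.- γ d) (a ⊗ m ⊗ c ^ (d ∸ 1)) (weight a ℚ.+ weight m) (c ^ d))
                  (+ᶜ-congʳ ((weight a ℚ.+ weight m) ·ᶜ C d)
                            (·ᶜ-cong (ℚ.- γ d) (≈ˢ-trans (coeff-⊗ (a ⊗ m) (c ^ (d ∸ 1))) (⋆-⊗ a m (C (d ∸ 1)))))) ⟨
    coeff ((ℚ.- γ d) · (a ⊗ m ⊗ c ^ (d ∸ 1)) ⊕ (weight a ℚ.+ weight m) · c ^ d) ∎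
    where
    regroup : ∀ wa wm x y z → wa ℚ.* x ℚ.- y ℚ.+ (wm ℚ.* x ℚ.- z) ≡ (wa ℚ.+ wm) ℚ.* x ℚ.- (y ℚ.+ z)
    regroup = solve-∀ ℚ-ring
    swap : ∀ w x g y → w ℚ.* x ℚ.- g ℚ.* y ≡ ℚ.- g ℚ.* y ℚ.+ w ℚ.* x
    swap = solve-∀ ℚ-ring

  amcᵈ-vanishing : ∀ d → IsZeroOS n (a ⊗ m ⊗ c ^ d) →
                   IsZeroOS n ((ℚ.- weight m) · (a ⊗ c ^ d) ⊕ weight a · (m ⊗ c ^ d))
  amcᵈ-vanishing d vanishes =
    IsZeroOS-∂ (a ⊗ m ⊗ c ^ d) ((ℚ.- weight m) · (a ⊗ c ^ d) ⊕ weight a · (m ⊗ c ^ d)) vanishes (≈ˢ-sym (∂-amcᵈ d))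

  acᵈ+mcᵈ-vanishing : ∀ d → IsZeroOS n (a ⊗ c ^ d ⊕ m ⊗ c ^ d) →
                      IsZeroOS n ((ℚ.- γ d) · (a ⊗ m ⊗ c ^ (d ∸ 1)) ⊕ (weight a ℚ.+ weight m) · c ^ d)
  acᵈ+mcᵈ-vanishing d vanishes =
    IsZeroOS-∂ (a ⊗ c ^ d ⊕ m ⊗ c ^ d) ((ℚ.- γ d) · (a ⊗ m ⊗ c ^ (d ∸ 1)) ⊕ (weight a ℚ.+ weight m) · c ^ d)
               vanishes (≈ˢ-sym (∂-acᵈ+mcᵈ d))

lemma5p9 : (n : ℕ) → 2 ≤ n →
    ((d : ℕ) → LinIndep2 n (aE n ⊗ (cE n ^ d)) (mE n ⊗ (cE n ^ d))
      → ¬ IsZeroOS n (aE n ⊗ mE n ⊗ (cE n ^ d)))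
    × ((d : ℕ) → 1 ≤ d → LinIndep2 n (aE n ⊗ mE n ⊗ (cE n ^ (d ∸ 1))) (cE n ^ d)
      → ¬ IsZeroOS n ((aE n ⊗ (cE n ^ d)) ⊕ (mE n ⊗ (cE n ^ d))))
lemma5p9 (suc n) _ = part₁ , part₂
  where
  open Powers (suc n)

  part₁ : ∀ d → LinIndep2 (suc n) (a ⊗ c ^ d) (m ⊗ c ^ d) → ¬ IsZeroOS (suc n) (a ⊗ m ⊗ c ^ d)
  part₁ d independent vanishes =
    ℚₚ.<⇒≢ (m-positive n)
           (sym (ℚₚ.neg-injective {q = 0ℚ} (proj₁ (independent (ℚ.- weight m) (weight a) (amcᵈ-vanishing d vanishes)))))

  part₂ : ∀ d → 1 ≤ d → LinIndep2 (suc n) (a ⊗ m ⊗ c ^ (d ∸ 1)) (c ^ d) → ¬ IsZeroOS (suc n) (a ⊗ c ^ d ⊕ m ⊗ c ^ d)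
  part₂ d _ independent vanishes =
    ℚₚ.<⇒≢ (ℚₚ.+-mono-≤-< (a-nonNegative (suc n)) (m-positive n))
           (sym (proj₂ (independent (ℚ.- γ d) (weight a ℚ.+ weight m) (acᵈ+mcᵈ-vanishing d vanishes))))
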